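{- Let $k,n\in\mathbb{Z}^+$. (i) $\binom{kn}{n}\ \big|\ (2k-1)C_n\binom{2kn}{2n}$, and the quotient $(2k-1)C_n\binom{2kn}{2n}\big/\binom{kn}{n}$ is odd if and only if $n+1$ is a power of two. (ii) Let $(k+1)'$ denote the odd part of $k+1$ (i.e. $k+1$ divided by the largest power of $2$ dividing it). Then $\binom{2n}{n}\ \big|\ (k+1)'C_n^{(k-1)}\binom{2kn}{kn}$, and the quotient $(k+1)'C_n^{(k-1)}\binom{2kn}{kn}\big/\binom{2n}{n}$ is odd if and only if $(k-1)n+1$ is a power of two. (iii) $2^{k-1}\binom{2n}{n}\ \Big|\ \binom{2(2^k-1)n}{(2^k-1)n}C_n^{(2^k-2)}$.
   Context: $C_n=\frac{1}{n+1}\binom{2n}{n}$ is the $n$th Catalan number. For $h,m\in\mathbb{N}$, $C_m^{(h)}=\frac{1}{hm+1}\binom{(h+1)m}{m}$ is the generalized Catalan number of order $h$ (an integer). "Power of two" means $2^a$ for some $a\in\mathbb{N}$. -}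

module Defs where

open import Data.Nat using (ℕ; zero; suc; _+_; _*_; _∸_; _^_; _/_)
open import Data.Nat.Combinatorics using (_C_)
open import Data.Nat.Divisibility using (_∣_; _∣?_)
open import Relation.Nullary using (¬_)
open import Data.Product using (∃-syntax)
open import Relation.Binary.PropositionalEquality using (_≡_)
open import Relation.Nullary using (yes; no)

catalan : ℕ → ℕ
catalan n = ((2 * n) C n) / suc n

genCatalan : ℕ → ℕ → ℕ
genCatalan h m = ((suc h * m) C m) / suc (h * m)

IsPowerOfTwo : ℕ → Set
IsPowerOfTwo x = ∃[ a ] x ≡ 2 ^ a

-- odd part of m: m divided by the largest power of 2 dividing it (oddPart 0 = 0).
-- fuel-based; fuel m suffices since each halving step strictly decreases m.
oddPartAux : ℕ → ℕ → ℕ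
oddPartAux zero m = m
oddPartAux (suc fuel) zero = zero
oddPartAux (suc fuel) (suc m) with 2 ∣? suc m
... | yes _ = oddPartAux fuel (suc m / 2)
... | no _  = suc m

oddPart : ℕ → ℕ
oddPart m = oddPartAux m m

Odd : ℕ → Set
Odd q = ¬ (2 ∣ q)

module Submission where

-- Each divisibility B ∣ A is cleared of denominators: for a suitable
-- D we have B·D = L and A·D = R with L and R products of factorials (times a
-- small extra factor), so B ∣ A follows from L ∣ R, which is checked prime by
-- prime on p-adic valuations ν_p.
--  * Odd primes p: by Legendre's formula ν_p(m!) = Σ_{i≥1} ⌊m/pⁱ⌋ it suffices to
--    compare floors termwise.  For an odd modulus q = pⁱ this is an elementary
--    remainder computation whose single critical case forces q to divide the
--    extra factor (2k − 1 in part (i), k + 1 in parts (ii) and (iii)).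
--  * p = 2: ν₂(m!) = m − s₂(m) with s₂ the binary digit sum, and the floors
--    telescope into ν₂(R) − ν₂(L) = s₂(n + 1) − 1, resp. s₂((k − 1)n + 1) − 1.
--    This is ≥ 0, it vanishes exactly for powers of two (the parity claims), and
--    in part (iii) it is ≥ k − 1 since multiples of 2ʲ − 1 have ≥ j binary ones.

open import Defs
open import Data.Nat using (ℕ; suc; _≤_; _+_; _*_; _∸_; _^_)
open import Data.Nat.Combinatorics using (_C_)
open import Data.Nat.Divisibility using (_∣_)
open import Data.Product using (_×_)
open import Function.Bundles using (_⇔_)
open import Relation.Binary.PropositionalEquality using (_≡_)

open import Data.Nat.Base
open import Data.Nat.Properties
open import Data.Nat.Divisibility
open import Data.Nat.DivMod
open import Data.Nat.Primality
open import Data.Nat.Primality.Factorisation using (factorise; PrimeFactorisation; factors)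
open import Data.Nat.Combinatorics using (nCk≡n!/k![n-k]!; k![n∸k]!∣n!)
open import Data.Nat.Induction using (<-rec)
open import Data.Nat.ListAction using (product)
open import Data.Nat.Tactic.RingSolver using (solve-∀)
open import Data.List.Base using (List; []; _∷_)
open import Data.List.Relation.Unary.All using (All; []; _∷_)
open import Data.Product.Base using (_,_; proj₁; proj₂; Σ-syntax)
open import Data.Sum.Base using (_⊎_; inj₁; inj₂)
open import Data.Empty using (⊥-elim)
open import Function.Bundles using (mk⇔)
open import Relation.Nullary using (¬_; Dec; yes; no)
open import Relation.Binary.PropositionalEquality

pos-factorˡ : ∀ a b → 1 ≤ a * b → 1 ≤ a
pos-factorˡ (suc a) b _ = s≤s z≤n

pos-factorʳ : ∀ a b → 1 ≤ a * b → 1 ≤ b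
pos-factorʳ a b 1≤ab = pos-factorˡ b a (subst (1 ≤_) (*-comm a b) 1≤ab)

double : ∀ n → 2 * n ≡ n + n
double n = cong (n +_) (+-identityʳ n)

∣-respʳ : ∀ {d x y} → x ≡ y → d ∣ x → d ∣ y
∣-respʳ {d} = subst (d ∣_)

-- The p-adic valuation ν p m: the largest e with pᵉ ∣ m (for m ≥ 1, p ≥ 2).
-- Computed by repeated division, with fuel m (each division shrinks m).
ν-fuel : ℕ → ℕ → ℕ → ℕ
ν-fuel zero     p m = 0
ν-fuel (suc fuel) p m with p ∣? m
... | no _              = 0
... | yes (divides c _) = suc (ν-fuel fuel p c)

ν : ℕ → ℕ → ℕ
ν p m = ν-fuel m p m

n<2^n : ∀ n → n < 2 ^ n
n<2^n zero    = s≤s z≤n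
n<2^n (suc n) = +-mono-≤ (m^n>0 2 n) (≤-trans (n<2^n n) (≤-reflexive (sym (+-identityʳ (2 ^ n)))))

module Valuation (p : ℕ) (2≤p : 2 ≤ p) where

  instance
    p≢0 : NonZero p
    p≢0 = >-nonZero (≤-trans (s≤s z≤n) 2≤p)

  pow-∣-pow : ∀ {e f} → e ≤ f → p ^ e ∣ p ^ f
  pow-∣-pow {f = f} z≤n      = 1∣ (p ^ f)
  pow-∣-pow (s≤s e≤f) = *-monoʳ-∣ p (pow-∣-pow e≤f)

  ν-fuel-spec : ∀ fuel m → 1 ≤ m → m ≤ fuel →
                p ^ ν-fuel fuel p m ∣ m × ¬ (p ^ suc (ν-fuel fuel p m) ∣ m)
  ν-fuel-spec (suc fuel) m 1≤m m≤fuel with p ∣? m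
  ... | no p∤m = 1∣ m , λ p¹∣m → p∤m (subst (_∣ m) (*-identityʳ p) p¹∣m)
  ... | yes (divides c m≡cp) = ∣-respʳ (sym m≡pc) (*-monoʳ-∣ p pᵉ∣c) , pᵉ⁺²∤m
    where
    1≤c : 1 ≤ c
    1≤c = pos-factorˡ c p (subst (1 ≤_) m≡cp 1≤m)
    c<m : c < m
    c<m = subst (c <_) (sym m≡cp) (m<m*n c p {{>-nonZero 1≤c}} 2≤p)
    m≡pc : m ≡ p * c
    m≡pc = trans m≡cp (*-comm c p)
    ih = ν-fuel-spec fuel c 1≤c (≤-pred (≤-trans c<m m≤fuel))
    pᵉ∣c : p ^ ν-fuel fuel p c ∣ c
    pᵉ∣c = proj₁ ih
    pᵉ⁺²∤m : ¬ (p ^ suc (suc (ν-fuel fuel p c)) ∣ m)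
    pᵉ⁺²∤m d = proj₂ ih (*-cancelˡ-∣ p (∣-respʳ m≡pc d))
  ν-fuel-spec zero m 1≤m m≤0 = ⊥-elim (<⇒≱ 1≤m m≤0)

  ν-divides : ∀ m → 1 ≤ m → p ^ ν p m ∣ m
  ν-divides m 1≤m = proj₁ (ν-fuel-spec m m 1≤m ≤-refl)

  ν-maximal : ∀ m → 1 ≤ m → ¬ (p ^ suc (ν p m) ∣ m)
  ν-maximal m 1≤m = proj₂ (ν-fuel-spec m m 1≤m ≤-refl)

  ≤ν⇒pow∣ : ∀ m e → 1 ≤ m → e ≤ ν p m → p ^ e ∣ m
  ≤ν⇒pow∣ m e 1≤m e≤ν = ∣-trans (pow-∣-pow e≤ν) (ν-divides m 1≤m)

  pow∣⇒≤ν : ∀ m e → 1 ≤ m → p ^ e ∣ m → e ≤ ν p m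
  pow∣⇒≤ν m e 1≤m pᵉ∣m with e ≤? ν p m
  ... | yes e≤ν = e≤ν
  ... | no  e≰ν = ⊥-elim (ν-maximal m 1≤m (∣-trans (pow-∣-pow (≰⇒> e≰ν)) pᵉ∣m))

  ν-unique : ∀ m x → 1 ≤ m → (∀ e → p ^ e ∣ m → e ≤ x) → p ^ x ∣ m → ν p m ≡ x
  ν-unique m x 1≤m bound pˣ∣m =
    ≤-antisym (bound (ν p m) (ν-divides m 1≤m)) (pow∣⇒≤ν m x 1≤m pˣ∣m)

  ν-coprime : ∀ m → 1 ≤ m → ¬ p ∣ m → ν p m ≡ 0
  ν-coprime m 1≤m p∤m = ν-unique m 0 1≤m bound (1∣ m)
    where
    bound : ∀ e → p ^ e ∣ m → e ≤ 0
    bound zero    _      = z≤n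
    bound (suc e) pᵉ⁺¹∣m = ⊥-elim (p∤m (∣-trans (m∣m*n (p ^ e)) pᵉ⁺¹∣m))

  ν-1 : ν p 1 ≡ 0
  ν-1 = ν-coprime 1 ≤-refl (λ p∣1 → <⇒≱ 2≤p (∣⇒≤ p∣1))

  -- ν p m ≤ m, since 2^ν ≤ p^ν ≤ m; this bounds the range of Legendre sums.
  ν≤ : ∀ m → 1 ≤ m → ν p m ≤ m
  ν≤ m 1≤m = begin
    ν p m      ≤⟨ <⇒≤ (n<2^n (ν p m)) ⟩
    2 ^ ν p m  ≤⟨ ^-monoˡ-≤ (ν p m) 2≤p ⟩
    p ^ ν p m  ≤⟨ ∣⇒≤ {{>-nonZero 1≤m}} (ν-divides m 1≤m) ⟩
    m          ∎
    where open ≤-Reasoning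

prime⇒2≤ : ∀ {p} → Prime p → 2 ≤ p
prime⇒2≤ {p} p-prime = nonTrivial⇒n>1 p {{prime⇒nonTrivial p-prime}}

module PrimeValuation (p : ℕ) (p-prime : Prime p) where

  open Valuation p (prime⇒2≤ p-prime) public

  p-part : ∀ a → 1 ≤ a → Σ[ a′ ∈ ℕ ] a ≡ a′ * p ^ ν p a × ¬ (p ∣ a′)
  p-part a 1≤a with ν-divides a 1≤a
  ... | divides a′ a≡a′pᵉ = a′ , a≡a′pᵉ , λ p∣a′ →
        ν-maximal a 1≤a (∣-respʳ (sym a≡a′pᵉ) (*-monoˡ-∣ (p ^ ν p a) p∣a′))

  -- The valuation is additive on products (this is where primality is used).
  ν-* : ∀ a b → 1 ≤ a → 1 ≤ b → ν p (a * b) ≡ ν p a + ν p b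
  ν-* a b 1≤a 1≤b with p-part a 1≤a | p-part b 1≤b
  ... | a′ , a≡ , p∤a′ | b′ , b≡ , p∤b′ =
        ν-unique (a * b) e (*-mono-≤ 1≤a 1≤b) bound (∣-respʳ (sym ab≡) (n∣m*n (a′ * b′)))
    where
    e = ν p a + ν p b
    ab≡ : a * b ≡ (a′ * b′) * p ^ e
    ab≡ = begin
      a * b                                 ≡⟨ cong₂ _*_ a≡ b≡ ⟩
      (a′ * p ^ ν p a) * (b′ * p ^ ν p b)   ≡⟨ interchange a′ (p ^ ν p a) b′ (p ^ ν p b) ⟩
      (a′ * b′) * (p ^ ν p a * p ^ ν p b)   ≡⟨ cong ((a′ * b′) *_) (sym (^-distribˡ-+-* p (ν p a) (ν p b))) ⟩
      (a′ * b′) * p ^ e                     ∎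
      where
      open ≡-Reasoning
      interchange : ∀ w x y z → (w * x) * (y * z) ≡ (w * y) * (x * z)
      interchange = solve-∀
    bound : ∀ f → p ^ f ∣ a * b → f ≤ e
    bound f pᶠ∣ab with f ≤? e
    ... | yes f≤e = f≤e
    ... | no  f≰e with euclidsLemma a′ b′ p-prime p∣a′b′
      where
      pᵉ⁺¹∣ : p * p ^ e ∣ (a′ * b′) * p ^ e
      pᵉ⁺¹∣ = ∣-respʳ ab≡ (∣-trans (pow-∣-pow (≰⇒> f≰e)) pᶠ∣ab)
      p∣a′b′ : p ∣ a′ * b′
      p∣a′b′ = *-cancelʳ-∣ (p ^ e) {{m^n≢0 p e}} pᵉ⁺¹∣
    ... | inj₁ p∣a′ = ⊥-elim (p∤a′ p∣a′)
    ... | inj₂ p∣b′ = ⊥-elim (p∤b′ p∣b′)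

  ν-*₃ : ∀ x y z → 1 ≤ x → 1 ≤ y → 1 ≤ z → ν p (x * (y * z)) ≡ ν p x + ν p y + ν p z
  ν-*₃ x y z 1≤x 1≤y 1≤z = begin
    ν p (x * (y * z))          ≡⟨ ν-* x (y * z) 1≤x (*-mono-≤ 1≤y 1≤z) ⟩
    ν p x + ν p (y * z)        ≡⟨ cong (ν p x +_) (ν-* y z 1≤y 1≤z) ⟩
    ν p x + (ν p y + ν p z)    ≡⟨ +-assoc (ν p x) _ _ ⟨
    ν p x + ν p y + ν p z      ∎
    where open ≡-Reasoning

-- Divisibility criterion: B ∣ A as soon as ν r B ≤ ν r A for every prime r.
-- Proved along a prime factorisation of B, peeling off one prime at a time.
module _ where
  open PrimeValuation using (ν-*; ≤ν⇒pow∣)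

  ν-criterion-list : ∀ ps → All Prime ps → ∀ A → 1 ≤ A →
                     (∀ r → Prime r → ν r (product ps) ≤ ν r A) → product ps ∣ A
  ν-criterion-list []       _                A _   _     = 1∣ A
  ν-criterion-list (p ∷ ps) (p-prime ∷ prs) A 1≤A ν≤ =
    ∣-respʳ (sym A≡pA′) (*-monoʳ-∣ p (ν-criterion-list ps prs A′ 1≤A′ ν≤′))
    where
    1≤p : 1 ≤ p
    1≤p = ≤-trans (s≤s z≤n) (prime⇒2≤ p-prime)
    1≤P : 1 ≤ product ps
    1≤P = productOfPrimes≥1 prs
    1≤νp : 1 ≤ ν p p
    1≤νp = PrimeValuation.pow∣⇒≤ν p p-prime p 1 1≤p (subst (_∣ p) (sym (*-identityʳ p)) ∣-refl)
    p∣A : p ∣ A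
    p∣A = subst (_∣ A) (*-identityʳ p) (≤ν⇒pow∣ p p-prime A 1 1≤A (begin
      1                              ≤⟨ 1≤νp ⟩
      ν p p                          ≤⟨ m≤m+n (ν p p) _ ⟩
      ν p p + ν p (product ps)       ≡⟨ ν-* p p-prime p (product ps) 1≤p 1≤P ⟨
      ν p (p * product ps)           ≤⟨ ν≤ p p-prime ⟩
      ν p A                          ∎))
      where open ≤-Reasoning
    A′ = quotient p∣A
    A≡pA′ : A ≡ p * A′
    A≡pA′ = m∣n⇒n≡m*quotient p∣A
    1≤A′ : 1 ≤ A′
    1≤A′ = pos-factorʳ p A′ (subst (1 ≤_) A≡pA′ 1≤A)
    ν≤′ : ∀ r → Prime r → ν r (product ps) ≤ ν r A′
    ν≤′ r r-prime = +-cancelˡ-≤ (ν r p) _ _ (begin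
      ν r p + ν r (product ps)  ≡⟨ ν-* r r-prime p (product ps) 1≤p 1≤P ⟨
      ν r (p * product ps)      ≤⟨ ν≤ r r-prime ⟩
      ν r A                     ≡⟨ cong (ν r) A≡pA′ ⟩
      ν r (p * A′)              ≡⟨ ν-* r r-prime p A′ 1≤p 1≤A′ ⟩
      ν r p + ν r A′            ∎)
      where open ≤-Reasoning

  ν-criterion : ∀ B A → 1 ≤ B → 1 ≤ A → (∀ r → Prime r → ν r B ≤ ν r A) → B ∣ A
  ν-criterion B A 1≤B 1≤A ν≤ = subst (_∣ A) (sym B≡∏) (ν-criterion-list (factors fB)
      (PrimeFactorisation.factorsPrime fB) A 1≤A (λ r r-prime → subst (λ x → ν r x ≤ ν r A) B≡∏ (ν≤ r r-prime)))
    where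
    fB = factorise B {{>-nonZero 1≤B}}
    B≡∏ = PrimeFactorisation.isFactorisation fB

Σ₁ : ℕ → (ℕ → ℕ) → ℕ
Σ₁ zero    f = 0
Σ₁ (suc F) f = Σ₁ F f + f (suc F)

Σ₁-cong : ∀ F {f g} → (∀ i → f i ≡ g i) → Σ₁ F f ≡ Σ₁ F g
Σ₁-cong zero    f≡g = refl
Σ₁-cong (suc F) f≡g = cong₂ _+_ (Σ₁-cong F f≡g) (f≡g (suc F))

-- Only the terms with index i ≥ 1 are compared.
Σ₁-mono : ∀ F {f g} → (∀ i → f (suc i) ≤ g (suc i)) → Σ₁ F f ≤ Σ₁ F g
Σ₁-mono zero    f≤g = z≤n
Σ₁-mono (suc F) f≤g = +-mono-≤ (Σ₁-mono F f≤g) (f≤g F)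

Σ₁-+ : ∀ F f g → Σ₁ F (λ i → f i + g i) ≡ Σ₁ F f + Σ₁ F g
Σ₁-+ zero    f g = refl
Σ₁-+ (suc F) f g = trans (cong (_+ (f (suc F) + g (suc F))) (Σ₁-+ F f g))
                         (shuffle (Σ₁ F f) (Σ₁ F g) (f (suc F)) (g (suc F)))
  where
  shuffle : ∀ a b c d → a + b + (c + d) ≡ a + c + (b + d)
  shuffle = solve-∀

Σ₁-zero : ∀ F → Σ₁ F (λ _ → 0) ≡ 0
Σ₁-zero zero    = refl
Σ₁-zero (suc F) = trans (+-identityʳ _) (Σ₁-zero F)

𝟙 : ∀ {P : Set} → Dec P → ℕ
𝟙 (yes _) = 1
𝟙 (no _)  = 0

𝟙-≤1 : ∀ {P : Set} (d : Dec P) → 𝟙 d ≤ 1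
𝟙-≤1 (yes _) = ≤-refl
𝟙-≤1 (no _)  = z≤n

𝟙-yes : ∀ {P : Set} (d : Dec P) → P → 𝟙 d ≡ 1
𝟙-yes (yes _) _  = refl
𝟙-yes (no ¬p) p  = ⊥-elim (¬p p)

𝟙-no : ∀ {P : Set} (d : Dec P) → ¬ P → 𝟙 d ≡ 0
𝟙-no (yes p) ¬p = ⊥-elim (¬p p)
𝟙-no (no _)  _  = refl

𝟙-⇔ : ∀ {P Q : Set} (d : Dec P) (e : Dec Q) → (P → Q) → (Q → P) → 𝟙 d ≡ 𝟙 e
𝟙-⇔ (yes _) (yes _) _ _ = refl
𝟙-⇔ (yes p) (no ¬q) f _ = ⊥-elim (¬q (f p))
𝟙-⇔ (no ¬p) (yes q) _ g = ⊥-elim (¬p (g q))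
𝟙-⇔ (no _)  (no _)  _ _ = refl

Σ₁-count : ∀ F V → Σ₁ F (λ i → 𝟙 (i ≤? V)) ≡ F ⊓ V
Σ₁-count zero    V = refl
Σ₁-count (suc F) V with suc F ≤? V
... | yes F<V = begin
  Σ₁ F _ + 1  ≡⟨ cong (_+ 1) (trans (Σ₁-count F V) (m≤n⇒m⊓n≡m (<⇒≤ F<V))) ⟩
  F + 1       ≡⟨ +-comm F 1 ⟩
  suc F       ≡⟨ m≤n⇒m⊓n≡m F<V ⟨
  suc F ⊓ V   ∎
  where open ≡-Reasoning
... | no  F≮V = begin
  Σ₁ F _ + 0  ≡⟨ +-identityʳ _ ⟩
  Σ₁ F _      ≡⟨ Σ₁-count F V ⟩
  F ⊓ V       ≡⟨ m≥n⇒m⊓n≡n V≤F ⟩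
  V           ≡⟨ m≥n⇒m⊓n≡n (m≤n⇒m≤1+n V≤F) ⟨
  suc F ⊓ V   ∎
  where
  open ≡-Reasoning
  V≤F : V ≤ F
  V≤F = ≤-pred (≰⇒> F≮V)

div-unique : ∀ {q} .{{_ : NonZero q}} r d → r < q → (r + d * q) / q ≡ d
div-unique {q} r d r<q = begin
  (r + d * q) / q        ≡⟨ +-distrib-/-∣ʳ r (n∣m*n d) ⟩
  r / q + d * q / q      ≡⟨ cong₂ _+_ (m<n⇒m/n≡0 r<q) (m*n/n≡m d q) ⟩
  d                      ∎
  where open ≡-Reasoning

floor-suc : ∀ m q .{{_ : NonZero q}} → suc m / q ≡ m / q + 𝟙 (q ∣? suc m)
floor-suc m q with m % q | m / q | m%n<n m q | m≡m%n+[m/n]*n m q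
... | r | d | r<q | m≡ with suc r <? q
...   | yes 1+r<q = begin
  suc m / q              ≡⟨ /-congˡ (cong suc m≡) ⟩
  (suc r + d * q) / q    ≡⟨ div-unique (suc r) d 1+r<q ⟩
  d                      ≡⟨ +-identityʳ d ⟨
  d + 0                  ≡⟨ cong (d +_) (𝟙-no (q ∣? suc m) q∤) ⟨
  d + 𝟙 (q ∣? suc m)     ∎
  where
  open ≡-Reasoning
  q∤ : ¬ q ∣ suc m
  q∤ q∣ = 1+n≢0 (begin
    suc r                  ≡⟨ m<n⇒m%n≡m 1+r<q ⟨
    suc r % q              ≡⟨ [m+kn]%n≡m%n (suc r) d q ⟨
    (suc r + d * q) % q    ≡⟨ %-congˡ (cong suc m≡) ⟨
    suc m % q              ≡⟨ n∣m⇒m%n≡0 (suc m) q q∣ ⟩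
    0                      ∎)
...   | no 1+r≮q = begin
  suc m / q              ≡⟨ /-congˡ m+1≡ ⟩
  suc d * q / q          ≡⟨ m*n/n≡m (suc d) q ⟩
  suc d                  ≡⟨ +-comm 1 d ⟩
  d + 1                  ≡⟨ cong (d +_) (𝟙-yes (q ∣? suc m) (divides (suc d) m+1≡)) ⟨
  d + 𝟙 (q ∣? suc m)     ∎
  where
  open ≡-Reasoning
  m+1≡ : suc m ≡ suc d * q
  m+1≡ = trans (cong suc m≡) (cong (_+ d * q) (≤-antisym r<q (≮⇒≥ 1+r≮q)))

module Legendre (p : ℕ) (p-prime : Prime p) where

  open PrimeValuation p p-prime

  ⌊_/p^_⌋ : ℕ → ℕ → ℕ
  ⌊ m /p^ i ⌋ = (m / p ^ i) {{m^n≢0 p i}}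

  count-prime-powers : ∀ N F → 1 ≤ N → ν p N ≤ F → Σ₁ F (λ i → 𝟙 (p ^ i ∣? N)) ≡ ν p N
  count-prime-powers N F 1≤N ν≤F = begin
    Σ₁ F (λ i → 𝟙 (p ^ i ∣? N))    ≡⟨ Σ₁-cong F same-indicator ⟩
    Σ₁ F (λ i → 𝟙 (i ≤? ν p N))    ≡⟨ Σ₁-count F (ν p N) ⟩
    F ⊓ ν p N                      ≡⟨ m≥n⇒m⊓n≡n ν≤F ⟩
    ν p N                          ∎
    where
    open ≡-Reasoning
    same-indicator : ∀ i → 𝟙 (p ^ i ∣? N) ≡ 𝟙 (i ≤? ν p N)
    same-indicator i = 𝟙-⇔ (p ^ i ∣? N) (i ≤? ν p N) (pow∣⇒≤ν N i 1≤N) (≤ν⇒pow∣ N i 1≤N)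

  legendre : ∀ F m → m ≤ F → ν p (m !) ≡ Σ₁ F (λ i → ⌊ m /p^ i ⌋)
  legendre F zero _ = begin
    ν p 1                       ≡⟨ ν-1 ⟩
    0                           ≡⟨ Σ₁-zero F ⟨
    Σ₁ F (λ _ → 0)              ≡⟨ Σ₁-cong F (λ i → 0/n≡0 (p ^ i) {{m^n≢0 p i}}) ⟨
    Σ₁ F (λ i → ⌊ 0 /p^ i ⌋)      ∎
    where open ≡-Reasoning
  legendre F (suc m) 1+m≤F = begin
    ν p (suc m * m !)
      ≡⟨ ν-* (suc m) (m !) (s≤s z≤n) (1≤n! m) ⟩
    ν p (suc m) + ν p (m !)
      ≡⟨ cong₂ _+_ (sym (count-prime-powers (suc m) F (s≤s z≤n) ν≤F)) (legendre F m (<⇒≤ 1+m≤F)) ⟩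
    Σ₁ F (λ i → 𝟙 (p ^ i ∣? suc m)) + Σ₁ F (λ i → ⌊ m /p^ i ⌋)
      ≡⟨ Σ₁-+ F _ _ ⟨
    Σ₁ F (λ i → 𝟙 (p ^ i ∣? suc m) + ⌊ m /p^ i ⌋)
      ≡⟨ Σ₁-cong F step ⟩
    Σ₁ F (λ i → ⌊ suc m /p^ i ⌋)
      ∎
    where
    open ≡-Reasoning
    ν≤F : ν p (suc m) ≤ F
    ν≤F = ≤-trans (ν≤ (suc m) (s≤s z≤n)) 1+m≤F
    step : ∀ i → 𝟙 (p ^ i ∣? suc m) + ⌊ m /p^ i ⌋ ≡ ⌊ suc m /p^ i ⌋
    step i = trans (+-comm _ ⌊ m /p^ i ⌋) (sym (floor-suc m (p ^ i) {{m^n≢0 p i}}))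

  ν-factorials-≤ : ∀ a b c N d e → 1 ≤ N →
    (∀ i → ⌊ a /p^ suc i ⌋ + ⌊ b /p^ suc i ⌋ + ⌊ c /p^ suc i ⌋
             ≤ 𝟙 (p ^ suc i ∣? N) + ⌊ d /p^ suc i ⌋ + ⌊ e /p^ suc i ⌋) →
    ν p (a ! * (b ! * c !)) ≤ ν p (N * (d ! * e !))
  ν-factorials-≤ a b c N d e 1≤N termwise = begin
    ν p (a ! * (b ! * c !))
      ≡⟨ ν-*₃ (a !) (b !) (c !) (1≤n! a) (1≤n! b) (1≤n! c) ⟩
    ν p (a !) + ν p (b !) + ν p (c !)
      ≡⟨ cong₂ _+_ (cong₂ _+_ (legendre F a a≤F) (legendre F b b≤F)) (legendre F c c≤F) ⟩
    Σ₁ F ⌊ a /p^_⌋ + Σ₁ F ⌊ b /p^_⌋ + Σ₁ F ⌊ c /p^_⌋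
      ≡⟨ Σ₁-+₃ ⌊ a /p^_⌋ ⌊ b /p^_⌋ ⌊ c /p^_⌋ ⟨
    Σ₁ F (λ i → ⌊ a /p^ i ⌋ + ⌊ b /p^ i ⌋ + ⌊ c /p^ i ⌋)
      ≤⟨ Σ₁-mono F termwise ⟩
    Σ₁ F (λ i → 𝟙 (p ^ i ∣? N) + ⌊ d /p^ i ⌋ + ⌊ e /p^ i ⌋)
      ≡⟨ Σ₁-+₃ (λ i → 𝟙 (p ^ i ∣? N)) ⌊ d /p^_⌋ ⌊ e /p^_⌋ ⟩
    Σ₁ F (λ i → 𝟙 (p ^ i ∣? N)) + Σ₁ F ⌊ d /p^_⌋ + Σ₁ F ⌊ e /p^_⌋
      ≡⟨ cong₂ _+_ (cong₂ _+_ (count-prime-powers N F 1≤N ν≤F) (sym (legendre F d d≤F))) (sym (legendre F e e≤F)) ⟩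
    ν p N + ν p (d !) + ν p (e !)
      ≡⟨ ν-*₃ N (d !) (e !) 1≤N (1≤n! d) (1≤n! e) ⟨
    ν p (N * (d ! * e !))
      ∎
    where
    open ≤-Reasoning
    -- A common range F for all six Legendre sums.
    F = a + (b + (c + (N + (d + e))))
    ≤F₅ : d + e ≤ F
    ≤F₅ = ≤-trans (m≤n+m _ N) (≤-trans (m≤n+m _ c) (≤-trans (m≤n+m _ b) (m≤n+m _ a)))
    a≤F : a ≤ F
    a≤F = m≤m+n a _
    b≤F : b ≤ F
    b≤F = ≤-trans (m≤m+n b _) (m≤n+m _ a)
    c≤F : c ≤ F
    c≤F = ≤-trans (m≤m+n c _) (≤-trans (m≤n+m _ b) (m≤n+m _ a))
    N≤F : N ≤ F
    N≤F = ≤-trans (m≤m+n N _) (≤-trans (m≤n+m _ c) (≤-trans (m≤n+m _ b) (m≤n+m _ a)))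
    d≤F : d ≤ F
    d≤F = ≤-trans (m≤m+n d e) ≤F₅
    e≤F : e ≤ F
    e≤F = ≤-trans (m≤n+m e d) ≤F₅
    ν≤F : ν p N ≤ F
    ν≤F = ≤-trans (ν≤ N 1≤N) N≤F
    Σ₁-+₃ : ∀ f g h → Σ₁ F (λ i → f i + g i + h i) ≡ Σ₁ F f + Σ₁ F g + Σ₁ F h
    Σ₁-+₃ f g h = trans (Σ₁-+ F (λ i → f i + g i) h) (cong (_+ Σ₁ F h) (Σ₁-+ F f g))

-- Floor estimates for an odd modulus q ≥ 2 (used with q = pⁱ, p an odd prime).
module FloorBounds (q : ℕ) .{{_ : NonZero q}} (2≤q : 2 ≤ q) (q-odd : ¬ 2 ∣ q) where

  -- carry r = 1 iff doubling the remainder r overflows q.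
  carry : ℕ → ℕ
  carry r = 𝟙 (q ≤? 2 * r)

  carry-mono : ∀ {r r′} → r ≤ r′ → carry r ≤ carry r′
  carry-mono {r} {r′} r≤r′ with q ≤? 2 * r | q ≤? 2 * r′
  ... | yes _   | yes _    = ≤-refl
  ... | yes q≤  | no  q≰′  = ⊥-elim (q≰′ (≤-trans q≤ (*-monoʳ-≤ 2 r≤r′)))
  ... | no _    | _        = z≤n

  carry-0 : carry 0 ≡ 0
  carry-0 = 𝟙-no (q ≤? 0) (<⇒≱ (≤-trans (s≤s z≤n) 2≤q))

  carry-top : ∀ {t} → suc t ≡ q → carry t ≡ 1
  carry-top {t} 1+t≡q = 𝟙-yes (q ≤? 2 * t) (subst (_≤ 2 * t) 1+t≡q (begin
    suc t        ≤⟨ +-monoʳ-≤ 1 (m≤m+n t 0) ⟩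
    1 + (t + 0)  ≤⟨ +-monoˡ-≤ (t + 0) 1≤t ⟩
    t + (t + 0)  ∎))
    where
    open ≤-Reasoning
    1≤t : 1 ≤ t
    1≤t = ≤-pred (subst (2 ≤_) (sym 1+t≡q) 2≤q)

  barely-carries : ∀ r → q ≤ 2 * r → 2 * r ≤ suc q → 2 * r ≡ suc q
  barely-carries r q≤2r 2r≤1+q = ≤-antisym 2r≤1+q (≤∧≢⇒< q≤2r q≢2r)
    where
    q≢2r : q ≢ 2 * r
    q≢2r q≡2r = q-odd (divides r (trans q≡2r (*-comm 2 r)))

  carry-split : ∀ {s u t A B} → s < q → u < q → t < q → s + u + A * q ≡ t + B * q →
                (B ≡ A × t ≡ s + u) ⊎ (B ≡ suc A × t + q ≡ s + u)
  carry-split {s} {u} {t} {A} {B} s<q u<q t<q eq with s + u <? q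
  ... | yes s+u<q = inj₁ (B≡A , +-cancelʳ-≡ (B * q) t (s + u) (trans (sym eq) (cong (λ z → s + u + z * q) (sym B≡A))))
    where
    B≡A : B ≡ A
    B≡A = trans (sym (div-unique t B t<q)) (trans (/-congˡ (sym eq)) (div-unique (s + u) A s+u<q))
  ... | no  s+u≮q = inj₂ (B≡1+A , trans (cong (_+ q) t≡w) (m∸n+n≡m q≤s+u))
    where
    q≤s+u : q ≤ s + u
    q≤s+u = ≮⇒≥ s+u≮q
    w = s + u ∸ q
    w<q : w < q
    w<q = +-cancelʳ-< q w q (subst (_< q + q) (sym (m∸n+n≡m q≤s+u)) (+-mono-< s<q u<q))
    eq′ : s + u + A * q ≡ w + suc A * q
    eq′ = trans (cong (λ z → z + A * q) (sym (m∸n+n≡m q≤s+u))) (+-assoc w q (A * q))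
    B≡1+A : B ≡ suc A
    B≡1+A = trans (sym (div-unique t B t<q)) (trans (/-congˡ (trans (sym eq) eq′)) (div-unique w (suc A) w<q))
    t≡w : t ≡ w
    t≡w = +-cancelʳ-≡ (B * q) t w (trans (sym eq) (trans eq′ (cong (λ z → w + z * q) (sym B≡1+A))))

  euclid : ∀ x → x ≡ x % q + x / q * q
  euclid x = m≡m%n+[m/n]*n x q

  double-floor : ∀ x → (2 * x) / q ≡ 2 * (x / q) + carry (x % q)
  double-floor x with carry-split r<q r<q (m%n<n (2 * x) q) 2x≡
    where
    r<q = m%n<n x q
    2x≡ : x % q + x % q + (x / q + x / q) * q ≡ (2 * x) % q + (2 * x) / q * q
    2x≡ = trans (regroup (x % q) (x / q) q) (trans (cong (2 *_) (sym (euclid x))) (euclid (2 * x)))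
      where
      regroup : ∀ r a q → r + r + (a + a) * q ≡ 2 * (r + a * q)
      regroup = solve-∀
  ... | inj₁ (⌊2x⌋≡ , 2r≡) = begin
    (2 * x) / q                  ≡⟨ ⌊2x⌋≡ ⟩
    x / q + x / q                ≡⟨ double (x / q) ⟨
    2 * (x / q)                  ≡⟨ +-identityʳ _ ⟨
    2 * (x / q) + 0              ≡⟨ cong (2 * (x / q) +_) (𝟙-no (q ≤? 2 * (x % q)) no-carry) ⟨
    2 * (x / q) + carry (x % q)  ∎
    where
    open ≡-Reasoning
    no-carry : ¬ q ≤ 2 * (x % q)
    no-carry = <⇒≱ (subst (_< q) (trans 2r≡ (sym (double (x % q)))) (m%n<n (2 * x) q))
  ... | inj₂ (⌊2x⌋≡ , 2r≡) = begin
    (2 * x) / q                  ≡⟨ ⌊2x⌋≡ ⟩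
    suc (x / q + x / q)          ≡⟨ cong suc (double (x / q)) ⟨
    suc (2 * (x / q))            ≡⟨ +-comm 1 _ ⟩
    2 * (x / q) + 1              ≡⟨ cong (2 * (x / q) +_) (𝟙-yes (q ≤? 2 * (x % q)) overflow) ⟨
    2 * (x / q) + carry (x % q)  ∎
    where
    open ≡-Reasoning
    overflow : q ≤ 2 * (x % q)
    overflow = subst (q ≤_) (trans 2r≡ (sym (double (x % q)))) (m≤n+m q _)

  -- A remainder u ≤ t + 1 carries at most when t does, except in the critical
  -- configuration 2u = q + 1, 2t + 1 = q (possible only because q is odd).
  carry-suc : ∀ {u t c} → u ≤ suc t → (2 * u ≡ suc q → suc (2 * t) ≡ q → 1 ≤ c) →
              carry u ≤ c + carry t
  carry-suc {u} {t} {c} u≤1+t critical with q ≤? 2 * t | q ≤? 2 * u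
  ... | yes _   | q≤?2u   = ≤-trans (𝟙-≤1 q≤?2u) (m≤n+m 1 c)
  ... | no _    | no _    = z≤n
  ... | no q≰2t | yes q≤2u = ≤-trans (critical 2u≡ 2t+1≡) (m≤m+n c 0)
    where
    2u≤2t+2 : 2 * u ≤ suc (suc (2 * t))
    2u≤2t+2 = ≤-trans (*-monoʳ-≤ 2 u≤1+t) (≤-reflexive (*-distribˡ-+ 2 1 t))
    2t+1≤q : suc (2 * t) ≤ q
    2t+1≤q = ≰⇒> q≰2t
    2u≡ : 2 * u ≡ suc q
    2u≡ = barely-carries u q≤2u (≤-trans 2u≤2t+2 (s≤s 2t+1≤q))
    2t+1≡ : suc (2 * t) ≡ q
    2t+1≡ = ≤-antisym 2t+1≤q (≤-pred (subst (_≤ suc (suc (2 * t))) 2u≡ 2u≤2t+2))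

  ∣suc⇔ : ∀ n → (q ∣ suc n → suc (n % q) ≡ q) × (suc (n % q) ≡ q → q ∣ suc n)
  ∣suc⇔ n = to , from
    where
    1+n≡ : suc n ≡ suc (n % q) + n / q * q
    1+n≡ = cong suc (euclid n)
    to : q ∣ suc n → suc (n % q) ≡ q
    to q∣ = ≤-antisym (m%n<n n q) (∣⇒≤ (∣m+n∣m⇒∣n (∣-respʳ 1+n≡′ q∣) (n∣m*n (n / q))))
      where
      1+n≡′ : suc n ≡ n / q * q + suc (n % q)
      1+n≡′ = trans 1+n≡ (+-comm (suc (n % q)) _)
    from : suc (n % q) ≡ q → q ∣ suc n
    from 1+r≡q = divides (suc (n / q)) (trans 1+n≡ (cong (_+ n / q * q) 1+r≡q))

  -- Bound I on remainders: with n = s + a q, y = u + c q, n + y = t + b q and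
  -- A = a + c, the floor inequality reduces to the following one.
  bound-I-core : ∀ {s u t A b N} (d? : Dec (suc s ≡ q)) → s < q → u < q → t < q →
    s + u + A * q ≡ t + b * q → (suc s ≡ q → 2 * u ≡ suc q → q ∣ N) →
    A + 𝟙 d? + carry u ≤ 𝟙 (q ∣? N) + b + carry t
  bound-I-core {s} {u} {t} {A} {b} {N} d? s<q u<q t<q eq critical
    with carry-split {s} {u} {t} {A} {b} s<q u<q t<q eq | d?
  ... | inj₁ (refl , t≡s+u) | no _ = begin
    A + 0 + carry u          ≤⟨ +-monoʳ-≤ (A + 0) (carry-mono (subst (u ≤_) (sym t≡s+u) (m≤n+m u s))) ⟩
    A + 0 + carry t          ≤⟨ +-monoˡ-≤ (carry t) (+-monoʳ-≤ A z≤n) ⟩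
    A + c + carry t          ≡⟨ cong (_+ carry t) (+-comm A c) ⟩
    c + A + carry t          ∎
    where
    open ≤-Reasoning
    c = 𝟙 (q ∣? N)
  ... | inj₁ (refl , t≡s+u) | yes 1+s≡q = begin
    A + 1 + carry u          ≡⟨ cong (A + 1 +_) (trans (cong carry u≡0) carry-0) ⟩
    A + 1 + 0                ≡⟨ +-identityʳ (A + 1) ⟩
    A + 1                    ≡⟨ cong (A +_) (carry-top 1+t≡q) ⟨
    A + carry t              ≤⟨ +-monoˡ-≤ (carry t) (m≤n+m A c) ⟩
    c + A + carry t          ∎
    where
    open ≤-Reasoning
    c = 𝟙 (q ∣? N)
    u≡0 : u ≡ 0
    u≡0 = n<1⇒n≡0 (+-cancelˡ-< s u 1 (subst (s + u <_) (trans (sym 1+s≡q) (+-comm 1 s)) (subst (_< q) t≡s+u t<q)))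
    1+t≡q : suc t ≡ q
    1+t≡q = trans (cong suc (trans t≡s+u (trans (cong (s +_) u≡0) (+-identityʳ s)))) 1+s≡q
  ... | inj₂ (refl , t+q≡s+u) | no _ = begin
    A + 0 + carry u          ≤⟨ +-monoʳ-≤ (A + 0) (𝟙-≤1 (q ≤? 2 * u)) ⟩
    A + 0 + 1                ≡⟨ cong (_+ 1) (+-identityʳ A) ⟩
    A + 1                    ≡⟨ +-comm A 1 ⟩
    suc A                    ≤⟨ m≤n+m (suc A) c ⟩
    c + suc A                ≤⟨ m≤m+n (c + suc A) (carry t) ⟩
    c + suc A + carry t      ∎
    where
    open ≤-Reasoning
    c = 𝟙 (q ∣? N)
  ... | inj₂ (refl , t+q≡s+u) | yes 1+s≡q = begin
    A + 1 + carry u          ≤⟨ +-monoʳ-≤ (A + 1) (carry-suc (≤-reflexive u≡1+t) bad) ⟩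
    A + 1 + (c + carry t)    ≡⟨ regroup A c (carry t) ⟩
    c + suc A + carry t      ∎
    where
    open ≤-Reasoning
    c = 𝟙 (q ∣? N)
    regroup : ∀ A c x → A + 1 + (c + x) ≡ c + suc A + x
    regroup = solve-∀
    u≡1+t : u ≡ suc t
    u≡1+t = +-cancelˡ-≡ s u (suc t) (begin-equality
      s + u        ≡⟨ t+q≡s+u ⟨
      t + q        ≡⟨ cong (t +_) 1+s≡q ⟨
      t + suc s    ≡⟨ +-suc t s ⟩
      suc (t + s)  ≡⟨ cong suc (+-comm t s) ⟩
      suc (s + t)  ≡⟨ +-suc s t ⟨
      s + suc t    ∎)
    bad : 2 * u ≡ suc q → suc (2 * t) ≡ q → 1 ≤ c
    bad 2u≡ _ = ≤-reflexive (sym (𝟙-yes (q ∣? N) (critical 1+s≡q 2u≡)))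

  floor-bound-I : ∀ k′ n →
    (n + k′ * n) / q + suc n / q + (2 * (k′ * n)) / q
      ≤ 𝟙 (q ∣? suc (2 * k′)) + (2 * (n + k′ * n)) / q + (k′ * n) / q
  floor-bound-I k′ n = begin
    b + suc n / q + (2 * y) / q    ≡⟨ cong₂ (λ x z → b + x + z) (floor-suc n q) (double-floor y) ⟩
    b + (a + 𝟙 (q ∣? suc n)) + (2 * c + carry u)
                                   ≡⟨ cong (λ z → b + (a + z) + (2 * c + carry u)) d≡ ⟩
    b + (a + 𝟙 d?) + (2 * c + carry u)
                                   ≡⟨ regroup₁ a b c (𝟙 d?) (carry u) ⟩
    (a + c + 𝟙 d? + carry u) + (b + c)
                                   ≤⟨ +-monoˡ-≤ (b + c) core ⟩
    (𝟙 (q ∣? N) + b + carry t) + (b + c)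
                                   ≡⟨ regroup₂ (𝟙 (q ∣? N)) b c (carry t) ⟩
    𝟙 (q ∣? N) + (2 * b + carry t) + c
                                   ≡⟨ cong (λ z → 𝟙 (q ∣? N) + z + c) (double-floor m) ⟨
    𝟙 (q ∣? N) + (2 * m) / q + c   ∎
    where
    open ≤-Reasoning
    y = k′ * n
    m = n + y
    N = suc (2 * k′)
    a = n / q
    s = n % q
    c = y / q
    u = y % q
    b = m / q
    t = m % q
    d? = suc s ≟ q
    d≡ : 𝟙 (q ∣? suc n) ≡ 𝟙 d?
    d≡ = 𝟙-⇔ (q ∣? suc n) d? (proj₁ (∣suc⇔ n)) (proj₂ (∣suc⇔ n))
    regroup₁ : ∀ a b c d x → b + (a + d) + (2 * c + x) ≡ (a + c + d + x) + (b + c)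
    regroup₁ = solve-∀
    regroup₂ : ∀ e b c x → (e + b + x) + (b + c) ≡ e + (2 * b + x) + c
    regroup₂ = solve-∀
    n+y≡m : s + u + (a + c) * q ≡ t + b * q
    n+y≡m = trans (regroup₃ s u a c q) (trans (cong₂ _+_ (sym (euclid n)) (sym (euclid y))) (euclid m))
      where
      regroup₃ : ∀ s u a c q → s + u + (a + c) * q ≡ (s + a * q) + (u + c * q)
      regroup₃ = solve-∀
    -- In the critical case 2k′(n + 1) ≡ 0 and 2y ≡ 1 (mod q), so q ∣ 2k′ + 1.
    critical : suc s ≡ q → 2 * u ≡ suc q → q ∣ N
    critical 1+s≡q 2u≡1+q = ∣m+n∣m⇒∣n (divides (2 * k′ * suc a) chain) (n∣m*n (2 * c + 1))
      where
      chain : (2 * c + 1) * q + N ≡ 2 * k′ * suc a * q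
      chain = begin-equality
        (2 * c + 1) * q + N            ≡⟨ e₁ c q k′ ⟩
        2 * k′ + (suc q + 2 * c * q)   ≡⟨ cong (λ z → 2 * k′ + (z + 2 * c * q)) 2u≡1+q ⟨
        2 * k′ + (2 * u + 2 * c * q)   ≡⟨ e₂ k′ u c q ⟩
        2 * k′ + 2 * (u + c * q)       ≡⟨ cong (λ z → 2 * k′ + 2 * z) (euclid y) ⟨
        2 * k′ + 2 * (k′ * n)          ≡⟨ e₃ k′ n ⟩
        2 * k′ * suc n                 ≡⟨ cong (λ z → 2 * k′ * suc z) (euclid n) ⟩
        2 * k′ * (suc s + a * q)       ≡⟨ cong (λ z → 2 * k′ * (z + a * q)) 1+s≡q ⟩
        2 * k′ * (q + a * q)           ≡⟨ e₄ k′ q a ⟩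
        2 * k′ * suc a * q             ∎
        where
        e₁ : ∀ c q k′ → (2 * c + 1) * q + suc (2 * k′) ≡ 2 * k′ + (suc q + 2 * c * q)
        e₁ = solve-∀
        e₂ : ∀ k′ u c q → 2 * k′ + (2 * u + 2 * c * q) ≡ 2 * k′ + 2 * (u + c * q)
        e₂ = solve-∀
        e₃ : ∀ k′ n → 2 * k′ + 2 * (k′ * n) ≡ 2 * k′ * suc n
        e₃ = solve-∀
        e₄ : ∀ k′ q a → 2 * k′ * (q + a * q) ≡ 2 * k′ * suc a * q
        e₄ = solve-∀
    core : a + c + 𝟙 d? + carry u ≤ 𝟙 (q ∣? N) + b + carry t
    core = bound-I-core {A = a + c} d? (m%n<n n q) (m%n<n y q) (m%n<n m q) n+y≡m critical

  -- Bound II on remainders: with n = s + a q, y + 1 = u + c q, n + y = t + b q and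
  -- A = a + c, the floor inequality reduces to the following one.
  bound-II-core : ∀ {s u t A b N} → s < q → u < q → t < q →
    s + u + A * q ≡ suc t + b * q → (2 * s ≡ suc q → suc (2 * t) ≡ q → q ∣ N) →
    A + carry s ≤ 𝟙 (q ∣? N) + b + carry t
  bound-II-core {s} {u} {t} {A} {b} {N} s<q u<q t<q eq critical with suc t ≟ q
  ... | yes 1+t≡q with carry-split {s} {u} {0} {A} {suc b} s<q u<q (≤-trans (s≤s z≤n) 2≤q) eq′
    where
    eq′ : s + u + A * q ≡ 0 + suc b * q
    eq′ = trans eq (cong (_+ b * q) 1+t≡q)
  ...   | inj₁ (A≡1+b , 0≡s+u) = begin
    A + carry s              ≡⟨ cong₂ _+_ (sym A≡1+b) (trans (cong carry s≡0) carry-0) ⟩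
    suc b + 0                ≡⟨ +-identityʳ (suc b) ⟩
    suc b                    ≡⟨ +-comm 1 b ⟩
    b + 1                    ≡⟨ cong (b +_) (carry-top 1+t≡q) ⟨
    b + carry t              ≤⟨ +-monoˡ-≤ (carry t) (m≤n+m b (𝟙 (q ∣? N))) ⟩
    𝟙 (q ∣? N) + b + carry t ∎
    where
    open ≤-Reasoning
    s≡0 : s ≡ 0
    s≡0 = n≤0⇒n≡0 (≤-trans (m≤m+n s u) (≤-reflexive (sym 0≡s+u)))
  ...   | inj₂ (refl , _) = begin
    b + carry s              ≤⟨ +-monoʳ-≤ b (𝟙-≤1 (q ≤? 2 * s)) ⟩
    b + 1                    ≡⟨ cong (b +_) (carry-top 1+t≡q) ⟨
    b + carry t              ≤⟨ +-monoˡ-≤ (carry t) (m≤n+m b (𝟙 (q ∣? N))) ⟩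
    𝟙 (q ∣? N) + b + carry t ∎
    where open ≤-Reasoning
  bound-II-core {s} {u} {t} {A} {b} {N} s<q u<q t<q eq critical
    | no 1+t≢q with carry-split {s} {u} {suc t} {A} {b} s<q u<q (≤∧≢⇒< t<q 1+t≢q) eq
  ... | inj₁ (refl , 1+t≡s+u) = begin
    A + carry s              ≤⟨ +-monoʳ-≤ A (carry-suc (subst (s ≤_) (sym 1+t≡s+u) (m≤m+n s u)) bad) ⟩
    A + (c + carry t)        ≡⟨ +-assoc A c (carry t) ⟨
    A + c + carry t          ≡⟨ cong (_+ carry t) (+-comm A c) ⟩
    c + A + carry t          ∎
    where
    open ≤-Reasoning
    c = 𝟙 (q ∣? N)
    bad : 2 * s ≡ suc q → suc (2 * t) ≡ q → 1 ≤ c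
    bad 2s≡ 2t+1≡ = ≤-reflexive (sym (𝟙-yes (q ∣? N) (critical 2s≡ 2t+1≡)))
  ... | inj₂ (refl , _) = begin
    A + carry s              ≤⟨ +-monoʳ-≤ A (𝟙-≤1 (q ≤? 2 * s)) ⟩
    A + 1                    ≡⟨ +-comm A 1 ⟩
    suc A                    ≤⟨ m≤n+m (suc A) (𝟙 (q ∣? N)) ⟩
    𝟙 (q ∣? N) + suc A       ≤⟨ m≤m+n _ (carry t) ⟩
    𝟙 (q ∣? N) + suc A + carry t ∎
    where open ≤-Reasoning

  floor-bound-II : ∀ h n →
    (2 * n) / q + suc (h * n) / q + (n + h * n) / q
      ≤ 𝟙 (q ∣? suc (suc h)) + n / q + (2 * (n + h * n)) / q
  floor-bound-II h n = begin
    (2 * n) / q + c + b            ≡⟨ cong (λ z → z + c + b) (double-floor n) ⟩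
    2 * a + carry s + c + b        ≡⟨ regroup₁ a b c (carry s) ⟩
    (a + c + carry s) + (a + b)    ≤⟨ +-monoˡ-≤ (a + b) core ⟩
    (𝟙 (q ∣? N) + b + carry t) + (a + b)
                                   ≡⟨ regroup₂ (𝟙 (q ∣? N)) a b (carry t) ⟩
    𝟙 (q ∣? N) + a + (2 * b + carry t)
                                   ≡⟨ cong (𝟙 (q ∣? N) + a +_) (double-floor m) ⟨
    𝟙 (q ∣? N) + a + (2 * m) / q   ∎
    where
    open ≤-Reasoning
    y = h * n
    m = n + y
    N = suc (suc h)
    a = n / q
    s = n % q
    c = suc y / q
    u = suc y % q
    b = m / q
    t = m % q
    regroup₁ : ∀ a b c x → 2 * a + x + c + b ≡ (a + c + x) + (a + b)
    regroup₁ = solve-∀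
    regroup₂ : ∀ e a b x → (e + b + x) + (a + b) ≡ e + a + (2 * b + x)
    regroup₂ = solve-∀
    n+y+1≡ : s + u + (a + c) * q ≡ suc t + b * q
    n+y+1≡ = begin-equality
      s + u + (a + c) * q              ≡⟨ regroup₃ s u a c q ⟩
      (s + a * q) + (u + c * q)        ≡⟨ cong₂ _+_ (euclid n) (euclid (suc y)) ⟨
      n + suc y                        ≡⟨ +-suc n y ⟩
      suc m                            ≡⟨ cong suc (euclid m) ⟩
      suc t + b * q                    ∎
      where
      regroup₃ : ∀ s u a c q → s + u + (a + c) * q ≡ (s + a * q) + (u + c * q)
      regroup₃ = solve-∀
    -- In the critical case 2n ≡ 1 and 2m ≡ −1 (mod q); as m = (h+1)n this
    -- gives h + 2 ≡ 0 (mod q).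
    critical : 2 * s ≡ suc q → suc (2 * t) ≡ q → q ∣ N
    critical 2s≡1+q 2t+1≡q = ∣m+n∣m⇒∣n (divides (2 * b + 1) chain) (n∣m*n (K * (2 * a + 1)))
      where
      K = suc h
      chain : K * (2 * a + 1) * q + suc K ≡ (2 * b + 1) * q
      chain = begin-equality
        K * (2 * a + 1) * q + suc K      ≡⟨ e₁ K a q ⟩
        suc (K * (suc q + 2 * a * q))    ≡⟨ cong (λ z → suc (K * (z + 2 * a * q))) 2s≡1+q ⟨
        suc (K * (2 * s + 2 * a * q))    ≡⟨ cong suc (e₂ K s a q) ⟩
        suc (2 * (K * (s + a * q)))      ≡⟨ cong (λ z → suc (2 * (K * z))) (euclid n) ⟨
        suc (2 * m)                      ≡⟨ cong (λ z → suc (2 * z)) (euclid m) ⟩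
        suc (2 * (t + b * q))            ≡⟨ e₃ t b q ⟩
        suc (2 * t) + 2 * b * q          ≡⟨ cong (_+ 2 * b * q) 2t+1≡q ⟩
        q + 2 * b * q                    ≡⟨ e₄ b q ⟩
        (2 * b + 1) * q                  ∎
        where
        e₁ : ∀ K a q → K * (2 * a + 1) * q + suc K ≡ suc (K * (suc q + 2 * a * q))
        e₁ = solve-∀
        e₂ : ∀ K s a q → K * (2 * s + 2 * a * q) ≡ 2 * (K * (s + a * q))
        e₂ = solve-∀
        e₃ : ∀ t b q → suc (2 * (t + b * q)) ≡ suc (2 * t) + 2 * b * q
        e₃ = solve-∀
        e₄ : ∀ b q → q + 2 * b * q ≡ (2 * b + 1) * q
        e₄ = solve-∀
    core : a + c + carry s ≤ 𝟙 (q ∣? N) + b + carry t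
    core = bound-II-core {A = a + c} (m%n<n n q) (m%n<n (suc y) q) (m%n<n m q) n+y+1≡ critical

odd-* : ∀ {a b} → ¬ 2 ∣ a → ¬ 2 ∣ b → ¬ 2 ∣ a * b
odd-* {a} {b} 2∤a 2∤b 2∣ab with euclidsLemma a b prime[2] 2∣ab
... | inj₁ 2∣a = 2∤a 2∣a
... | inj₂ 2∣b = 2∤b 2∣b

odd-^ : ∀ {a} i → ¬ 2 ∣ a → ¬ 2 ∣ a ^ i
odd-^ zero    _   2∣1 with ∣1⇒≡1 2∣1
... | ()
odd-^ (suc i) 2∤a = odd-* 2∤a (odd-^ i 2∤a)

odd-prime : ∀ {p} → Prime p → p ≢ 2 → ¬ 2 ∣ p
odd-prime p-prime p≢2 2∣p with prime⇒irreducible p-prime 2∣p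
... | inj₁ ()
... | inj₂ 2≡p = p≢2 (sym 2≡p)

module OddPrime (p : ℕ) (p-prime : Prime p) (p-odd : ¬ 2 ∣ p) where

  open Legendre p p-prime

  instance
    p≢0 : NonZero p
    p≢0 = prime⇒nonZero p-prime

  module Modulus (i : ℕ) =
    FloorBounds (p ^ suc i) {{m^n≢0 p (suc i)}}
      (≤-trans (prime⇒2≤ p-prime) (m≤m*n p (p ^ i) {{m^n≢0 p i}}))
      (odd-^ (suc i) p-odd)

  ν-bound-I : ∀ k′ n →
    ν p ((n + k′ * n) ! * (suc n ! * (2 * (k′ * n)) !))
      ≤ ν p (suc (2 * k′) * ((2 * (n + k′ * n)) ! * (k′ * n) !))
  ν-bound-I k′ n = ν-factorials-≤ (n + k′ * n) (suc n) (2 * (k′ * n)) (suc (2 * k′))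
    (2 * (n + k′ * n)) (k′ * n) (s≤s z≤n) (λ i → Modulus.floor-bound-I i k′ n)

  ν-bound-II : ∀ h n →
    ν p ((2 * n) ! * (suc (h * n) ! * (n + h * n) !))
      ≤ ν p (suc (suc h) * (n ! * (2 * (n + h * n)) !))
  ν-bound-II h n = ν-factorials-≤ (2 * n) (suc (h * n)) (n + h * n) (suc (suc h))
    n (2 * (n + h * n)) (s≤s z≤n) (λ i → Modulus.floor-bound-II i h n)

open PrimeValuation 2 prime[2] using () renaming
  ( ν-* to ν₂-*; ν-*₃ to ν₂-*₃; ν-1 to ν₂-1; ν-coprime to ν₂-odd
  ; ν-divides to ν₂-divides; pow∣⇒≤ν to pow∣⇒≤ν₂ )

data EvenOrOdd : ℕ → Set where
  even : ∀ j → EvenOrOdd (2 * j)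
  odd  : ∀ j → EvenOrOdd (suc (2 * j))

evenOrOdd : ∀ m → EvenOrOdd m
evenOrOdd zero = even 0
evenOrOdd (suc m) with evenOrOdd m
... | even j = odd j
... | odd j  = subst EvenOrOdd (2*-suc j) (even (suc j))
  where
  2*-suc : ∀ j → 2 * suc j ≡ suc (suc (2 * j))
  2*-suc = solve-∀

ν₂-double : ∀ x → 1 ≤ x → ν 2 (2 * x) ≡ suc (ν 2 x)
ν₂-double x 1≤x = ν₂-* 2 x (s≤s z≤n) 1≤x

2∤1+2j : ∀ j → ¬ 2 ∣ suc (2 * j)
2∤1+2j j 2∣ with ∣1⇒≡1 (∣m+n∣m⇒∣n (∣-respʳ (+-comm 1 (2 * j)) 2∣) (divides j (*-comm 2 j)))
... | ()

ν₂-!-odd′ : ∀ j → ν 2 ((2 * j) !) ≡ j + ν 2 (j !) → ν 2 (suc (2 * j) !) ≡ j + ν 2 (j !)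
ν₂-!-odd′ j ih = begin
  ν 2 (suc (2 * j) * (2 * j) !)           ≡⟨ ν₂-* (suc (2 * j)) ((2 * j) !) (s≤s z≤n) (1≤n! (2 * j)) ⟩
  ν 2 (suc (2 * j)) + ν 2 ((2 * j) !)     ≡⟨ cong₂ _+_ (ν₂-odd _ (s≤s z≤n) (2∤1+2j j)) ih ⟩
  j + ν 2 (j !)                           ∎
  where open ≡-Reasoning

ν₂-!-even : ∀ j → ν 2 ((2 * j) !) ≡ j + ν 2 (j !)
ν₂-!-even zero    = refl
ν₂-!-even (suc j) = begin
  ν 2 ((2 * suc j) !)
    ≡⟨ cong (λ z → ν 2 (z !)) 2+2j≡ ⟨
  ν 2 (suc (suc (2 * j)) * suc (2 * j) !)
    ≡⟨ ν₂-* (suc (suc (2 * j))) (suc (2 * j) !) (s≤s z≤n) (1≤n! (suc (2 * j))) ⟩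
  ν 2 (suc (suc (2 * j))) + ν 2 (suc (2 * j) !)
    ≡⟨ cong₂ _+_ (trans (cong (ν 2) 2+2j≡) (ν₂-double (suc j) (s≤s z≤n))) (ν₂-!-odd′ j (ν₂-!-even j)) ⟩
  suc (ν 2 (suc j)) + (j + ν 2 (j !))
    ≡⟨ regroup (ν 2 (suc j)) j (ν 2 (j !)) ⟩
  suc j + (ν 2 (suc j) + ν 2 (j !))
    ≡⟨ cong (suc j +_) (ν₂-* (suc j) (j !) (s≤s z≤n) (1≤n! j)) ⟨
  suc j + ν 2 (suc j !)
    ∎
  where
  open ≡-Reasoning
  2+2j≡ : suc (suc (2 * j)) ≡ 2 * suc j
  2+2j≡ = sym (*-distribˡ-+ 2 1 j)
  regroup : ∀ a j b → suc a + (j + b) ≡ suc j + (a + b)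
  regroup = solve-∀

ν₂-!-odd : ∀ j → ν 2 (suc (2 * j) !) ≡ j + ν 2 (j !)
ν₂-!-odd j = ν₂-!-odd′ j (ν₂-!-even j)

ν₂-!≤ : ∀ m → ν 2 (m !) ≤ m
ν₂-!≤ = <-rec (λ m → ν 2 (m !) ≤ m) step
  where
  step : ∀ m → (∀ {j} → j < m → ν 2 (j !) ≤ j) → ν 2 (m !) ≤ m
  step m rec with evenOrOdd m
  ... | even zero    = z≤n
  ... | even (suc j) = subst (_≤ 2 * suc j) (sym (ν₂-!-even (suc j)))
                         (+-monoʳ-≤ (suc j) (≤-trans (rec (m<m+n (suc j) (s≤s z≤n))) (m≤m+n (suc j) 0)))
  ... | odd j        = subst (_≤ suc (2 * j)) (sym (ν₂-!-odd j))
                         (m≤n⇒m≤1+n (+-monoʳ-≤ j (≤-trans (rec (s≤s (m≤m+n j (j + 0)))) (m≤m+n j 0))))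

-- s₂ m = m − ν₂(m!); by Legendre's formula this is the binary digit sum of m.
s₂ : ℕ → ℕ
s₂ m = m ∸ ν 2 (m !)

ν₂-!+s₂ : ∀ m → ν 2 (m !) + s₂ m ≡ m
ν₂-!+s₂ m = m+[n∸m]≡n (ν₂-!≤ m)

s₂-even : ∀ j → s₂ (2 * j) ≡ s₂ j
s₂-even j = +-cancelˡ-≡ (j + ν 2 (j !)) _ _ (begin
  j + ν 2 (j !) + s₂ (2 * j)     ≡⟨ cong (_+ s₂ (2 * j)) (ν₂-!-even j) ⟨
  ν 2 ((2 * j) !) + s₂ (2 * j)   ≡⟨ ν₂-!+s₂ (2 * j) ⟩
  2 * j                          ≡⟨ regroup j (ν 2 (j !)) (s₂ j) (ν₂-!+s₂ j) ⟩
  j + ν 2 (j !) + s₂ j           ∎)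
  where
  open ≡-Reasoning
  regroup : ∀ j a b → a + b ≡ j → 2 * j ≡ j + a + b
  regroup j a b refl = identity a b
    where
    identity : ∀ a b → 2 * (a + b) ≡ a + b + a + b
    identity = solve-∀

s₂-odd : ∀ j → s₂ (suc (2 * j)) ≡ suc (s₂ j)
s₂-odd j = +-cancelˡ-≡ (j + ν 2 (j !)) _ _ (begin
  j + ν 2 (j !) + s₂ (suc (2 * j))         ≡⟨ cong (_+ s₂ (suc (2 * j))) (ν₂-!-odd j) ⟨
  ν 2 (suc (2 * j) !) + s₂ (suc (2 * j))   ≡⟨ ν₂-!+s₂ (suc (2 * j)) ⟩
  suc (2 * j)                              ≡⟨ regroup j (ν 2 (j !)) (s₂ j) (ν₂-!+s₂ j) ⟩
  j + ν 2 (j !) + suc (s₂ j)               ∎)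
  where
  open ≡-Reasoning
  regroup : ∀ j a b → a + b ≡ j → suc (2 * j) ≡ j + a + suc b
  regroup j a b refl = identity a b
    where
    identity : ∀ a b → suc (2 * (a + b)) ≡ a + b + a + suc b
    identity = solve-∀

-- Subadditivity, from a! b! ∣ (a + b)!.
s₂-subadditive : ∀ a b → s₂ (a + b) ≤ s₂ a + s₂ b
s₂-subadditive a b = +-cancelˡ-≤ (ν 2 (a !) + ν 2 (b !)) _ _ (begin
  ν 2 (a !) + ν 2 (b !) + s₂ (a + b)            ≤⟨ +-monoˡ-≤ (s₂ (a + b)) ν₂-a!b! ⟩
  ν 2 ((a + b) !) + s₂ (a + b)                  ≡⟨ ν₂-!+s₂ (a + b) ⟩
  a + b                                         ≡⟨ cong₂ _+_ (ν₂-!+s₂ a) (ν₂-!+s₂ b) ⟨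
  (ν 2 (a !) + s₂ a) + (ν 2 (b !) + s₂ b)       ≡⟨ interchange (ν 2 (a !)) (s₂ a) (ν 2 (b !)) (s₂ b) ⟩
  ν 2 (a !) + ν 2 (b !) + (s₂ a + s₂ b)         ∎)
  where
  open ≤-Reasoning
  interchange : ∀ w x y z → (w + x) + (y + z) ≡ w + y + (x + z)
  interchange = solve-∀
  a!b!∣ : a ! * b ! ∣ (a + b) !
  a!b!∣ = subst (λ z → a ! * z ! ∣ (a + b) !) (m+n∸m≡n a b) (k![n∸k]!∣n! (m≤m+n a b))
  ν₂-a!b! : ν 2 (a !) + ν 2 (b !) ≤ ν 2 ((a + b) !)
  ν₂-a!b! = subst (_≤ ν 2 ((a + b) !)) (ν₂-* (a !) (b !) (1≤n! a) (1≤n! b))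
    (pow∣⇒≤ν₂ ((a + b) !) _ (1≤n! (a + b)) (∣-trans (ν₂-divides (a ! * b !) (*-mono-≤ (1≤n! a) (1≤n! b))) a!b!∣))

s₂-concat : ∀ j u w → w < 2 ^ j → s₂ (2 ^ j * u + w) ≡ s₂ u + s₂ w
s₂-concat zero    u zero    _ = trans (cong s₂ (trans (+-identityʳ _) (*-identityˡ u))) (sym (+-identityʳ _))
s₂-concat zero    u (suc w) (s≤s ())
s₂-concat (suc j) u w w<2ʲ⁺¹ with evenOrOdd w
... | even w′ = begin
  s₂ (2 * 2 ^ j * u + 2 * w′)      ≡⟨ cong s₂ (regroup (2 ^ j) u w′) ⟩
  s₂ (2 * (2 ^ j * u + w′))        ≡⟨ s₂-even (2 ^ j * u + w′) ⟩
  s₂ (2 ^ j * u + w′)              ≡⟨ s₂-concat j u w′ (*-cancelˡ-< 2 w′ (2 ^ j) w<2ʲ⁺¹) ⟩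
  s₂ u + s₂ w′                     ≡⟨ cong (s₂ u +_) (s₂-even w′) ⟨
  s₂ u + s₂ (2 * w′)               ∎
  where
  open ≡-Reasoning
  regroup : ∀ P u w → 2 * P * u + 2 * w ≡ 2 * (P * u + w)
  regroup = solve-∀
... | odd w′ = begin
  s₂ (2 * 2 ^ j * u + suc (2 * w′))   ≡⟨ cong s₂ (regroup (2 ^ j) u w′) ⟩
  s₂ (suc (2 * (2 ^ j * u + w′)))     ≡⟨ s₂-odd (2 ^ j * u + w′) ⟩
  suc (s₂ (2 ^ j * u + w′))           ≡⟨ cong suc (s₂-concat j u w′ (*-cancelˡ-< 2 w′ (2 ^ j) (<⇒≤ w<2ʲ⁺¹))) ⟩
  suc (s₂ u + s₂ w′)                  ≡⟨ +-suc (s₂ u) (s₂ w′) ⟨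
  s₂ u + suc (s₂ w′)                  ≡⟨ cong (s₂ u +_) (s₂-odd w′) ⟨
  s₂ u + s₂ (suc (2 * w′))            ∎
  where
  open ≡-Reasoning
  regroup : ∀ P u w → 2 * P * u + suc (2 * w) ≡ suc (2 * (P * u + w))
  regroup = solve-∀

s₂-ones : ∀ j → s₂ (2 ^ j ∸ 1) ≡ j
s₂-ones zero    = refl
s₂-ones (suc j) = trans (cong s₂ 2ʲ⁺¹-1≡) (trans (s₂-odd (2 ^ j ∸ 1)) (cong suc (s₂-ones j)))
  where
  2ʲ⁺¹-1≡ : 2 * 2 ^ j ∸ 1 ≡ suc (2 * (2 ^ j ∸ 1))
  2ʲ⁺¹-1≡ = begin
    2 * 2 ^ j ∸ 1                    ≡⟨ cong (λ z → 2 * z ∸ 1) (m+[n∸m]≡n (m^n>0 2 j)) ⟨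
    2 * (1 + (2 ^ j ∸ 1)) ∸ 1        ≡⟨ cong (_∸ 1) (*-distribˡ-+ 2 1 (2 ^ j ∸ 1)) ⟩
    suc (2 * (2 ^ j ∸ 1))            ∎
    where open ≡-Reasoning

s₂-pow : ∀ a → s₂ (2 ^ a) ≡ 1
s₂-pow zero    = refl
s₂-pow (suc a) = trans (s₂-even (2 ^ a)) (s₂-pow a)

-- Writing x = 2ʲ u + w (w < 2ʲ), the number u + w = x − (2ʲ − 1) u is a smaller
-- multiple of 2ʲ − 1 with s₂(u + w) ≤ s₂ u + s₂ w = s₂ x.
s₂-multiple : ∀ j x → 1 ≤ x → (2 ^ j ∸ 1) ∣ x → j ≤ s₂ x
s₂-multiple zero         _ _ _ = z≤n
s₂-multiple j@(suc j′) = <-rec (λ x → 1 ≤ x → M ∣ x → j ≤ s₂ x) step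
  where
  instance
    2ʲ≢0 : NonZero (2 ^ j)
    2ʲ≢0 = m^n≢0 2 j
  M = 2 ^ j ∸ 1
  1+M≡2ʲ : 1 + M ≡ 2 ^ j
  1+M≡2ʲ = m+[n∸m]≡n (m^n>0 2 j)
  step : ∀ x → (∀ {y} → y < x → 1 ≤ y → M ∣ y → j ≤ s₂ y) → 1 ≤ x → M ∣ x → j ≤ s₂ x
  step x rec 1≤x M∣x with x / 2 ^ j | x % 2 ^ j | m≡m%n+[m/n]*n x (2 ^ j) | m%n<n x (2 ^ j)
  ... | zero   | w | x≡ | w<2ʲ = ≤-reflexive (sym (trans (cong s₂ x≡M) (s₂-ones j)))
    where
    x≤M : x ≤ M
    x≤M = ≤-pred (subst (x <_) (sym 1+M≡2ʲ) (subst (_< 2 ^ j) (sym (trans x≡ (+-identityʳ w))) w<2ʲ))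
    x≡M : x ≡ M
    x≡M = ≤-antisym x≤M (∣⇒≤ {{>-nonZero 1≤x}} M∣x)
  ... | suc u′ | w | x≡ | w<2ʲ = begin
    j                  ≤⟨ rec u+w<x (m≤m+n 1 _) M∣u+w ⟩
    s₂ (u + w)         ≤⟨ s₂-subadditive u w ⟩
    s₂ u + s₂ w        ≡⟨ s₂-concat j u w w<2ʲ ⟨
    s₂ (2 ^ j * u + w) ≡⟨ cong s₂ x≡2ʲu+w ⟨
    s₂ x               ∎
    where
    open ≤-Reasoning
    u = suc u′
    x≡2ʲu+w : x ≡ 2 ^ j * u + w
    x≡2ʲu+w = trans x≡ (trans (+-comm w (u * 2 ^ j)) (cong (_+ w) (*-comm u (2 ^ j))))
    x≡Mu+u+w : x ≡ M * u + (u + w)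
    x≡Mu+u+w = trans x≡2ʲu+w (trans (cong (λ z → z * u + w) (sym 1+M≡2ʲ)) (regroup M u w))
      where
      regroup : ∀ M u w → (1 + M) * u + w ≡ M * u + (u + w)
      regroup = solve-∀
    M∣u+w : M ∣ u + w
    M∣u+w = ∣m+n∣m⇒∣n (∣-respʳ x≡Mu+u+w M∣x) (m∣m*n u)
    1≤M : 1 ≤ M
    1≤M = m<n⇒0<n∸m (^-monoʳ-< 2 (s≤s (s≤s z≤n)) {0} {j} (s≤s z≤n))
    u+w<x : u + w < x
    u+w<x = subst (u + w <_) (sym x≡Mu+u+w) (m<n+m (u + w) (*-mono-≤ 1≤M (s≤s z≤n)))

s₂-multiple-of-ones : ∀ j n → 1 ≤ n → j ≤ s₂ ((2 ^ j ∸ 1) * n)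
s₂-multiple-of-ones zero    n _   = z≤n
s₂-multiple-of-ones (suc j) n 1≤n = s₂-multiple (suc j) _ (*-mono-≤ 1≤2ʲ⁺¹-1 1≤n) (m∣m*n n)
  where
  1≤2ʲ⁺¹-1 : 1 ≤ 2 ^ suc j ∸ 1
  1≤2ʲ⁺¹-1 = m<n⇒0<n∸m (^-monoʳ-< 2 (s≤s (s≤s z≤n)) {0} {suc j} (s≤s z≤n))

1≤s₂ : ∀ m → 1 ≤ m → 1 ≤ s₂ m
1≤s₂ m 1≤m = s₂-multiple 1 m 1≤m (1∣ m)

s₂≡1⇒pow : ∀ m → 1 ≤ m → s₂ m ≡ 1 → IsPowerOfTwo m
s₂≡1⇒pow = <-rec (λ m → 1 ≤ m → s₂ m ≡ 1 → IsPowerOfTwo m) step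
  where
  step : ∀ m → (∀ {j} → j < m → 1 ≤ j → s₂ j ≡ 1 → IsPowerOfTwo j) → 1 ≤ m → s₂ m ≡ 1 → IsPowerOfTwo m
  step m rec 1≤m s₂m≡1 with evenOrOdd m
  ... | even zero = ⊥-elim (<⇒≱ 1≤m z≤n)
  ... | even (suc j) with rec (m<m+n (suc j) (s≤s z≤n)) (s≤s z≤n) (trans (sym (s₂-even (suc j))) s₂m≡1)
  ...   | a , 1+j≡2ᵃ = suc a , cong (2 *_) 1+j≡2ᵃ
  step m rec 1≤m s₂m≡1 | odd zero    = 0 , refl
  step m rec 1≤m s₂m≡1 | odd (suc j) = ⊥-elim (<⇒≱ (1≤s₂ (suc j) (s≤s z≤n)) (≤-reflexive s₂[1+j]≡0))
    where
    s₂[1+j]≡0 : s₂ (suc j) ≡ 0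
    s₂[1+j]≡0 = suc-injective (trans (sym (s₂-odd (suc j))) s₂m≡1)

binomial : ∀ a b → ((a + b) C a) * (a ! * b !) ≡ (a + b) !
binomial a b = begin
  ((a + b) C a) * (a ! * b !)
    ≡⟨ cong₂ _*_ (nCk≡n!/k![n-k]! (m≤m+n a b)) (cong (λ z → a ! * z !) (sym (m+n∸m≡n a b))) ⟩
  ((a + b) ! / (a ! * (a + b ∸ a) !)) {{a!b!≢0}} * (a ! * (a + b ∸ a) !)
                                     ≡⟨ m/n*n≡m {{a!b!≢0}} (k![n∸k]!∣n! (m≤m+n a b)) ⟩
  (a + b) !                          ∎
  where
  open ≡-Reasoning
  a!b!≢0 : NonZero (a ! * (a + b ∸ a) !)
  a!b!≢0 = >-nonZero (*-mono-≤ (1≤n! a) (1≤n! (a + b ∸ a)))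

central-binomial : ∀ n → ((2 * n) C n) * (n ! * n !) ≡ (2 * n) !
central-binomial n = subst (λ z → (z C n) * (n ! * n !) ≡ z !) (sym (double n)) (binomial n n)

-- Both sides equal (a+b+1)!/(a! b!).
binomial-swap : ∀ a b → ((suc a + b) C suc a) * suc a ≡ ((a + suc b) C a) * suc b
binomial-swap a b = *-cancelʳ-≡ _ _ (a ! * b !) {{>-nonZero (*-mono-≤ (1≤n! a) (1≤n! b))}} (begin
  X * suc a * (a ! * b !)        ≡⟨ regroup₁ X (suc a) (a !) (b !) ⟩
  X * (suc a ! * b !)            ≡⟨ binomial (suc a) b ⟩
  (suc a + b) !                  ≡⟨ cong _! (+-suc a b) ⟨
  (a + suc b) !                  ≡⟨ binomial a (suc b) ⟨
  Y * (a ! * suc b !)            ≡⟨ regroup₂ Y (suc b) (a !) (b !) ⟩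
  Y * suc b * (a ! * b !)        ∎)
  where
  open ≡-Reasoning
  X = (suc a + b) C suc a
  Y = (a + suc b) C a
  regroup₁ : ∀ X s x y → X * s * (x * y) ≡ X * ((s * x) * y)
  regroup₁ = solve-∀
  regroup₂ : ∀ Y s x y → Y * (x * (s * y)) ≡ Y * s * (x * y)
  regroup₂ = solve-∀

∣-from-congruence : ∀ X Y s t c → X * s ≡ Y * t → t ≡ c * s + 1 → t ∣ X
∣-from-congruence X Y s t c Xs≡Yt t≡cs+1 = ∣m+n∣m⇒∣n (∣-respʳ Xt≡ (n∣m*n X)) (n∣m*n (c * Y))
  where
  Xt≡ : X * t ≡ c * Y * t + X
  Xt≡ = begin
    X * t                    ≡⟨ cong (X *_) t≡cs+1 ⟩
    X * (c * s + 1)          ≡⟨ regroup X c s ⟩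
    c * (X * s) + X          ≡⟨ cong (λ z → c * z + X) Xs≡Yt ⟩
    c * (Y * t) + X          ≡⟨ cong (_+ X) (*-assoc c Y t) ⟨
    c * Y * t + X            ∎
    where
    open ≡-Reasoning
    regroup : ∀ X c s → X * (c * s + 1) ≡ c * (X * s) + X
    regroup = solve-∀

genCatalan-∣ : ∀ h n′ → suc (h * suc n′) ∣ (suc h * suc n′) C suc n′
genCatalan-∣ h n′ = ∣-from-congruence _ ((n′ + suc (h * n)) C n′) n (suc (h * n)) h
  (binomial-swap n′ (h * n)) (+-comm 1 (h * n))
  where n = suc n′

genCatalan-spec : ∀ h n′ → genCatalan h (suc n′) * suc (h * suc n′) ≡ (suc h * suc n′) C suc n′
genCatalan-spec h n′ = m/n*n≡m (genCatalan-∣ h n′)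

catalan-spec : ∀ n′ → catalan (suc n′) * suc (suc n′) ≡ (2 * suc n′) C suc n′
catalan-spec n′ = m/n*n≡m (subst (λ z → suc z ∣ (2 * n) C n) (*-identityˡ n) (genCatalan-∣ 1 n′))
  where n = suc n′

ν₂-2^ : ∀ e → ν 2 (2 ^ e) ≡ e
ν₂-2^ zero    = ν₂-1
ν₂-2^ (suc e) = trans (ν₂-double (2 ^ e) (m^n>0 2 e)) (cong suc (ν₂-2^ e))

ν-2^ : ∀ {p} → Prime p → p ≢ 2 → ∀ e → ν p (2 ^ e) ≡ 0
ν-2^ {p} p-prime p≢2 zero    = ν-1
  where open PrimeValuation p p-prime
ν-2^ {p} p-prime p≢2 (suc e) = begin
  ν p (2 * 2 ^ e)          ≡⟨ ν-* 2 (2 ^ e) (s≤s z≤n) (m^n>0 2 e) ⟩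
  ν p 2 + ν p (2 ^ e)      ≡⟨ cong₂ _+_ ν-2 (ν-2^ p-prime p≢2 e) ⟩
  0                        ∎
  where
  open ≡-Reasoning
  open PrimeValuation p p-prime
  ν-2 : ν p 2 ≡ 0
  ν-2 = ν-coprime 2 (s≤s z≤n) (λ p∣2 → p≢2 (≤-antisym (∣⇒≤ p∣2) (prime⇒2≤ p-prime)))

oddPartAux-spec : ∀ fuel m → 1 ≤ m → m ≤ fuel →
                  Σ[ e ∈ ℕ ] m ≡ 2 ^ e * oddPartAux fuel m × ¬ 2 ∣ oddPartAux fuel m
oddPartAux-spec (suc fuel) (suc m) _ m<fuel with 2 ∣? suc m
... | no 2∤ = 0 , sym (+-identityʳ _) , 2∤
... | yes (divides c 1+m≡c2) with oddPartAux-spec fuel (suc m / 2) 1≤c′ c′≤fuel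
  where
  c′≡c : suc m / 2 ≡ c
  c′≡c = trans (/-congˡ 1+m≡c2) (m*n/n≡m c 2)
  1≤c : 1 ≤ c
  1≤c = pos-factorˡ c 2 (subst (1 ≤_) 1+m≡c2 (s≤s z≤n))
  1≤c′ : 1 ≤ suc m / 2
  1≤c′ = subst (1 ≤_) (sym c′≡c) 1≤c
  c′≤fuel : suc m / 2 ≤ fuel
  c′≤fuel = ≤-pred (≤-trans (m/n<m (suc m) 2 (s≤s (s≤s z≤n))) m<fuel)
...   | e , c′≡ , 2∤ = suc e , 1+m≡ , 2∤
  where
  1+m≡ : suc m ≡ 2 ^ suc e * oddPartAux fuel (suc m / 2)
  1+m≡ = begin
    suc m                                     ≡⟨ m/n*n≡m (divides c 1+m≡c2) ⟨
    suc m / 2 * 2                             ≡⟨ cong (_* 2) c′≡ ⟩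
    2 ^ e * oddPartAux fuel (suc m / 2) * 2   ≡⟨ regroup (2 ^ e) _ ⟩
    2 * 2 ^ e * oddPartAux fuel (suc m / 2)   ∎
    where
    open ≡-Reasoning
    regroup : ∀ P O → P * O * 2 ≡ 2 * P * O
    regroup = solve-∀

oddPart-spec : ∀ m → 1 ≤ m → Σ[ e ∈ ℕ ] m ≡ 2 ^ e * oddPart m × ¬ 2 ∣ oddPart m
oddPart-spec m 1≤m = oddPartAux-spec m m 1≤m ≤-refl

1≤oddPart : ∀ m → 1 ≤ m → 1 ≤ oddPart m
1≤oddPart m 1≤m with oddPart-spec m 1≤m
... | e , m≡ , _ = pos-factorʳ (2 ^ e) _ (subst (1 ≤_) m≡ 1≤m)

ν-oddPart : ∀ {p} → Prime p → p ≢ 2 → ∀ m → 1 ≤ m → ν p (oddPart m) ≡ ν p m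
ν-oddPart {p} p-prime p≢2 m 1≤m with oddPart-spec m 1≤m
... | e , m≡ , _ = sym (begin
  ν p m                              ≡⟨ cong (ν p) m≡ ⟩
  ν p (2 ^ e * oddPart m)            ≡⟨ PrimeValuation.ν-* p p-prime (2 ^ e) (oddPart m) (m^n>0 2 e) (1≤oddPart m 1≤m) ⟩
  ν p (2 ^ e) + ν p (oddPart m)      ≡⟨ cong (_+ ν p (oddPart m)) (ν-2^ p-prime p≢2 e) ⟩
  ν p (oddPart m)                    ∎)
  where open ≡-Reasoning

-- Clearing denominators: if B·D = L and A·D = R, statements about B ∣ A and
-- about the quotient A/B are statements about the factorial products L and R.
∣-by-multiplier : ∀ {A B D L R} → 1 ≤ D → B * D ≡ L → A * D ≡ R → L ∣ R → B ∣ A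
∣-by-multiplier {D = D} 1≤D BD≡L AD≡R L∣R =
  *-cancelʳ-∣ D {{>-nonZero 1≤D}} (subst₂ _∣_ (sym BD≡L) (sym AD≡R) L∣R)

quotient-by-multiplier : ∀ {A B D L R} q → B * D ≡ L → A * D ≡ R → A ≡ q * B → q * L ≡ R
quotient-by-multiplier {A} {B} {D} {L} {R} q BD≡L AD≡R A≡qB = begin
  q * L          ≡⟨ cong (q *_) BD≡L ⟨
  q * (B * D)    ≡⟨ *-assoc q B D ⟨
  q * B * D      ≡⟨ cong (_* D) A≡qB ⟨
  A * D          ≡⟨ AD≡R ⟩
  R              ∎
  where open ≡-Reasoning

ν₂-quotient : ∀ {q L R} S → 1 ≤ q → 1 ≤ L → q * L ≡ R → ν 2 L + S ≡ suc (ν 2 R) → suc (ν 2 q) ≡ S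
ν₂-quotient {q} {L} {R} S 1≤q 1≤L qL≡R νL+S≡ = +-cancelˡ-≡ (ν 2 L) _ _ (begin
  ν 2 L + suc (ν 2 q)      ≡⟨ +-suc (ν 2 L) (ν 2 q) ⟩
  suc (ν 2 L + ν 2 q)      ≡⟨ cong suc (+-comm (ν 2 L) (ν 2 q)) ⟩
  suc (ν 2 q + ν 2 L)      ≡⟨ cong suc (ν₂-* q L 1≤q 1≤L) ⟨
  suc (ν 2 (q * L))        ≡⟨ cong (λ x → suc (ν 2 x)) qL≡R ⟩
  suc (ν 2 R)              ≡⟨ νL+S≡ ⟨
  ν 2 L + S                ∎)
  where open ≡-Reasoning

odd⇔power-of-two : ∀ q m → 1 ≤ q → 1 ≤ m → suc (ν 2 q) ≡ s₂ m → Odd q ⇔ IsPowerOfTwo m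
odd⇔power-of-two q m 1≤q 1≤m 1+ν≡s₂ = mk⇔ to from
  where
  to : Odd q → IsPowerOfTwo m
  to 2∤q = s₂≡1⇒pow m 1≤m (trans (sym 1+ν≡s₂) (cong suc (ν₂-odd q 1≤q 2∤q)))
  from : IsPowerOfTwo m → Odd q
  from (a , refl) 2∣q = <⇒≱ (s≤s 1≤ν) (≤-reflexive (trans 1+ν≡s₂ (s₂-pow a)))
    where
    1≤ν : 1 ≤ ν 2 q
    1≤ν = pow∣⇒≤ν₂ q 1 1≤q (subst (_∣ q) (sym (*-identityʳ 2)) 2∣q)

ν₂-identity-I : ∀ y n →
  ν 2 ((n + y) ! * (suc n ! * (2 * y) !)) + s₂ (suc n) ≡ suc (ν 2 ((2 * (n + y)) ! * y !))
ν₂-identity-I y n = begin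
  ν 2 (m ! * (suc n ! * (2 * y) !)) + s₂ (suc n)
    ≡⟨ cong (_+ s₂ (suc n)) (ν₂-*₃ (m !) (suc n !) ((2 * y) !) (1≤n! m) (1≤n! (suc n)) (1≤n! (2 * y))) ⟩
  ν 2 (m !) + ν 2 (suc n !) + ν 2 ((2 * y) !) + s₂ (suc n)
    ≡⟨ cong (λ z → ν 2 (m !) + ν 2 (suc n !) + z + s₂ (suc n)) (ν₂-!-even y) ⟩
  ν 2 (m !) + ν 2 (suc n !) + (y + ν 2 (y !)) + s₂ (suc n)
    ≡⟨ regroup₁ (ν 2 (m !)) (ν 2 (suc n !)) y (ν 2 (y !)) (s₂ (suc n)) ⟩
  ν 2 (m !) + (ν 2 (suc n !) + s₂ (suc n)) + y + ν 2 (y !)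
    ≡⟨ cong (λ z → ν 2 (m !) + z + y + ν 2 (y !)) (ν₂-!+s₂ (suc n)) ⟩
  ν 2 (m !) + suc n + y + ν 2 (y !)
    ≡⟨ regroup₂ (ν 2 (m !)) n y (ν 2 (y !)) ⟩
  suc (m + ν 2 (m !) + ν 2 (y !))
    ≡⟨ cong (λ z → suc (z + ν 2 (y !))) (ν₂-!-even m) ⟨
  suc (ν 2 ((2 * m) !) + ν 2 (y !))
    ≡⟨ cong suc (ν₂-* ((2 * m) !) (y !) (1≤n! (2 * m)) (1≤n! y)) ⟨
  suc (ν 2 ((2 * m) ! * y !))
    ∎
  where
  open ≡-Reasoning
  m = n + y
  regroup₁ : ∀ a b y c s → a + b + (y + c) + s ≡ a + (b + s) + y + c
  regroup₁ = solve-∀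
  regroup₂ : ∀ a n y c → a + suc n + y + c ≡ suc (n + y + a + c)
  regroup₂ = solve-∀

ν₂-identity-II : ∀ y n →
  ν 2 ((2 * n) ! * (suc y ! * (n + y) !)) + s₂ (suc y) ≡ suc (ν 2 (n ! * (2 * (n + y)) !))
ν₂-identity-II y n = begin
  ν 2 ((2 * n) ! * (suc y ! * m !)) + s₂ (suc y)
    ≡⟨ cong (_+ s₂ (suc y)) (ν₂-*₃ ((2 * n) !) (suc y !) (m !) (1≤n! (2 * n)) (1≤n! (suc y)) (1≤n! m)) ⟩
  ν 2 ((2 * n) !) + ν 2 (suc y !) + ν 2 (m !) + s₂ (suc y)
    ≡⟨ cong (λ z → z + ν 2 (suc y !) + ν 2 (m !) + s₂ (suc y)) (ν₂-!-even n) ⟩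
  n + ν 2 (n !) + ν 2 (suc y !) + ν 2 (m !) + s₂ (suc y)
    ≡⟨ regroup₁ n (ν 2 (n !)) (ν 2 (suc y !)) (ν 2 (m !)) (s₂ (suc y)) ⟩
  n + ν 2 (n !) + (ν 2 (suc y !) + s₂ (suc y)) + ν 2 (m !)
    ≡⟨ cong (λ z → n + ν 2 (n !) + z + ν 2 (m !)) (ν₂-!+s₂ (suc y)) ⟩
  n + ν 2 (n !) + suc y + ν 2 (m !)
    ≡⟨ regroup₂ n (ν 2 (n !)) y (ν 2 (m !)) ⟩
  suc (ν 2 (n !) + (m + ν 2 (m !)))
    ≡⟨ cong (λ z → suc (ν 2 (n !) + z)) (ν₂-!-even m) ⟨
  suc (ν 2 (n !) + ν 2 ((2 * m) !))
    ≡⟨ cong suc (ν₂-* (n !) ((2 * m) !) (1≤n! n) (1≤n! (2 * m))) ⟨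
  suc (ν 2 (n ! * (2 * m) !))
    ∎
  where
  open ≡-Reasoning
  m = n + y
  regroup₁ : ∀ n a b c s → n + a + b + c + s ≡ n + a + (b + s) + c
  regroup₁ = solve-∀
  regroup₂ : ∀ n a y c → n + a + suc y + c ≡ suc (a + (n + y + c))
  regroup₂ = solve-∀

ν≤-at-all-primes : ∀ {L R} → ν 2 L ≤ ν 2 R → (∀ p → Prime p → p ≢ 2 → ν p L ≤ ν p R) →
                   ∀ p → Prime p → ν p L ≤ ν p R
ν≤-at-all-primes ν₂≤ ν-odd≤ p p-prime with p ≟ 2
... | yes refl = ν₂≤
... | no  p≢2  = ν-odd≤ p p-prime p≢2

excess-≤ : ∀ {a b S} t → a + S ≡ suc b → suc t ≤ S → t + a ≤ b
excess-≤ {a} {b} {S} t a+S≡ 1+t≤S = ≤-pred (begin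
  suc (t + a)  ≡⟨ +-comm (suc t) a ⟩
  a + suc t    ≤⟨ +-monoʳ-≤ a 1+t≤S ⟩
  a + S        ≡⟨ a+S≡ ⟩
  suc b        ∎)
  where open ≤-Reasoning

ν₂-odd-factor : ∀ c X → 1 ≤ c → ¬ 2 ∣ c → 1 ≤ X → ν 2 (c * X) ≡ ν 2 X
ν₂-odd-factor c X 1≤c 2∤c 1≤X = trans (ν₂-* c X 1≤c 1≤X) (cong (_+ ν 2 X) (ν₂-odd c 1≤c 2∤c))

1≤!*! : ∀ a b → 1 ≤ a ! * b !
1≤!*! a b = *-mono-≤ (1≤n! a) (1≤n! b)

-- With k = k′+1, n ≥ 1, y = k′n, m = n + y = kn and the multiplier
-- D = n! y! (n+1)! (2y)!, the two sides become the factorial products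
--   C(kn, n) · D = m! (n+1)! (2y)!   and   (2k−1) C_n C(2kn, 2n) · D = (2k−1) (2m)! y!.
part-i : ∀ k′ n′ → let k = suc k′ ; n = suc n′ in
    ((k * n) C n ∣ (2 * k ∸ 1) * catalan n * ((2 * k * n) C (2 * n)))
  × ((q : ℕ) → (2 * k ∸ 1) * catalan n * ((2 * k * n) C (2 * n)) ≡ q * ((k * n) C n)
      → (Odd q ⇔ IsPowerOfTwo (n + 1)))
part-i k′ n′ = ∣-by-multiplier 1≤D BD≡L AD≡R (ν-criterion L R 1≤L 1≤R ν-L≤R) , quotient-parity
  where
  k = suc k′
  n = suc n′
  y = k′ * n
  m = n + y
  N = suc (2 * k′)
  Cat = catalan n
  B₂ = (2 * k * n) C (2 * n)
  A = (2 * k ∸ 1) * Cat * B₂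
  B = m C n
  D = (n ! * y !) * (suc n ! * (2 * y) !)
  L = m ! * (suc n ! * (2 * y) !)
  R = N * ((2 * m) ! * y !)
  1≤D : 1 ≤ D
  1≤D = *-mono-≤ (1≤!*! n y) (1≤!*! (suc n) (2 * y))
  1≤L : 1 ≤ L
  1≤L = *-mono-≤ (1≤n! m) (1≤!*! (suc n) (2 * y))
  1≤R : 1 ≤ R
  1≤R = *-mono-≤ {1} {N} (s≤s z≤n) (1≤!*! (2 * m) y)
  BD≡L : B * D ≡ L
  BD≡L = trans (sym (*-assoc B (n ! * y !) _)) (cong (_* (suc n ! * (2 * y) !)) (binomial n y))
  B₂-spec : B₂ * ((2 * n) ! * (2 * y) !) ≡ (2 * m) !
  B₂-spec = begin
    B₂ * ((2 * n) ! * (2 * y) !)                     ≡⟨ cong (λ z → (z C (2 * n)) * ((2 * n) ! * (2 * y) !)) (e₁ k′ n) ⟩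
    ((2 * n + 2 * y) C (2 * n)) * ((2 * n) ! * (2 * y) !) ≡⟨ binomial (2 * n) (2 * y) ⟩
    (2 * n + 2 * y) !                                ≡⟨ cong _! (*-distribˡ-+ 2 n y) ⟨
    (2 * m) !                                        ∎
    where
    open ≡-Reasoning
    e₁ : ∀ k′ n → 2 * suc k′ * n ≡ 2 * n + 2 * (k′ * n)
    e₁ = solve-∀
  AD≡R : A * D ≡ R
  AD≡R = begin
    (2 * k ∸ 1) * Cat * B₂ * ((n ! * y !) * (suc n * n ! * (2 * y) !))
      ≡⟨ regroup (2 * k ∸ 1) Cat B₂ (suc n) (n !) (y !) ((2 * y) !) ⟩
    (2 * k ∸ 1) * (B₂ * (Cat * suc n * (n ! * n !) * (2 * y) !) * y !)
      ≡⟨ cong (λ z → (2 * k ∸ 1) * (B₂ * (z * (n ! * n !) * (2 * y) !) * y !)) (catalan-spec n′) ⟩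
    (2 * k ∸ 1) * (B₂ * (((2 * n) C n) * (n ! * n !) * (2 * y) !) * y !)
      ≡⟨ cong (λ z → (2 * k ∸ 1) * (B₂ * (z * (2 * y) !) * y !)) (central-binomial n) ⟩
    (2 * k ∸ 1) * (B₂ * ((2 * n) ! * (2 * y) !) * y !)
      ≡⟨ cong₂ (λ w z → w * (z * y !)) (cong (_∸ 1) (*-distribˡ-+ 2 1 k′)) B₂-spec ⟩
    N * ((2 * m) ! * y !)
      ∎
    where
    open ≡-Reasoning
    regroup : ∀ c C B s f g h → c * C * B * ((f * g) * (s * f * h)) ≡ c * (B * (C * s * (f * f) * h) * g)
    regroup = solve-∀
  ν₂-identity : ν 2 L + s₂ (suc n) ≡ suc (ν 2 R)
  ν₂-identity = trans (ν₂-identity-I y n)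
    (cong suc (sym (ν₂-odd-factor N _ (s≤s z≤n) (2∤1+2j k′) (1≤!*! (2 * m) y))))
  ν-L≤R : ∀ p → Prime p → ν p L ≤ ν p R
  ν-L≤R = ν≤-at-all-primes {L} {R} (excess-≤ 0 ν₂-identity (1≤s₂ (suc n) (s≤s z≤n)))
    (λ p p-prime p≢2 → OddPrime.ν-bound-I p p-prime (odd-prime p-prime p≢2) k′ n)
  quotient-parity : (q : ℕ) → A ≡ q * B → Odd q ⇔ IsPowerOfTwo (n + 1)
  quotient-parity q A≡qB = subst (λ z → Odd q ⇔ IsPowerOfTwo z) (+-comm 1 n)
    (odd⇔power-of-two q (suc n) 1≤q (s≤s z≤n)
      (ν₂-quotient (s₂ (suc n)) 1≤q 1≤L (quotient-by-multiplier q BD≡L AD≡R A≡qB) ν₂-identity))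
    where
    1≤q : 1 ≤ q
    1≤q = pos-factorˡ q B (subst (1 ≤_) A≡qB (pos-factorˡ A D (subst (1 ≤_) (sym AD≡R) 1≤R)))

genCatalan-certificate : ∀ h n′ → let n = suc n′ ; y = h * n ; m = n + y in
  genCatalan h n * ((2 * m) C m) * ((n ! * n !) * (suc y ! * m !)) ≡ n ! * (2 * m) !
genCatalan-certificate h n′ = begin
  G * Bₘ * ((n ! * n !) * (suc y * y ! * m !))
    ≡⟨ regroup G Bₘ (suc y) (n !) (y !) (m !) ⟩
  n ! * (Bₘ * (G * suc y * (n ! * y !) * m !))
    ≡⟨ cong (λ z → n ! * (Bₘ * (z * (n ! * y !) * m !))) (genCatalan-spec h n′) ⟩
  n ! * (Bₘ * ((m C n) * (n ! * y !) * m !))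
    ≡⟨ cong (λ z → n ! * (Bₘ * (z * m !))) (binomial n y) ⟩
  n ! * (Bₘ * (m ! * m !))
    ≡⟨ cong (n ! *_) (central-binomial m) ⟩
  n ! * (2 * m) !
    ∎
  where
  open ≡-Reasoning
  n = suc n′
  y = h * n
  m = n + y
  G = genCatalan h n
  Bₘ = (2 * m) C m
  regroup : ∀ G B s f g M → G * B * ((f * f) * (s * g * M)) ≡ f * (B * (G * s * (f * g) * M))
  regroup = solve-∀

central-certificate : ∀ n X → ((2 * n) C n) * ((n ! * n !) * X) ≡ (2 * n) ! * X
central-certificate n X = trans (sym (*-assoc ((2 * n) C n) (n ! * n !) X)) (cong (_* X) (central-binomial n))

-- Part (ii).  With k = k′+1, y = k′n, m = n + y = kn and D = n! n! (y+1)! m!: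
--   C(2n, n) · D = (2n)! (y+1)! m!   and   (k+1)′ C_n^(k−1) C(2kn, kn) · D = (k+1)′ n! (2m)!.
part-ii : ∀ k′ n′ → let k = suc k′ ; n = suc n′ in
    ((2 * n) C n ∣ oddPart (k + 1) * genCatalan (k ∸ 1) n * ((2 * k * n) C (k * n)))
  × ((q : ℕ) → oddPart (k + 1) * genCatalan (k ∸ 1) n * ((2 * k * n) C (k * n)) ≡ q * ((2 * n) C n)
      → (Odd q ⇔ IsPowerOfTwo ((k ∸ 1) * n + 1)))
part-ii k′ n′ = ∣-by-multiplier 1≤D BD≡L AD≡R (ν-criterion L R 1≤L 1≤R ν-L≤R) , quotient-parity
  where
  k = suc k′
  n = suc n′
  y = k′ * n
  m = n + y
  1≤k+1 : 1 ≤ k + 1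
  1≤k+1 = m≤n+m 1 k
  O = oddPart (k + 1)
  1≤O : 1 ≤ O
  1≤O = 1≤oddPart (k + 1) 1≤k+1
  A = O * genCatalan k′ n * ((2 * k * n) C m)
  B = (2 * n) C n
  X = suc y ! * m !
  D = (n ! * n !) * X
  L = (2 * n) ! * X
  R′ = n ! * (2 * m) !
  R = O * R′
  1≤D : 1 ≤ D
  1≤D = *-mono-≤ (1≤!*! n n) (1≤!*! (suc y) m)
  1≤L : 1 ≤ L
  1≤L = *-mono-≤ (1≤n! (2 * n)) (1≤!*! (suc y) m)
  1≤R′ : 1 ≤ R′
  1≤R′ = 1≤!*! n (2 * m)
  1≤R : 1 ≤ R
  1≤R = *-mono-≤ 1≤O 1≤R′
  BD≡L : B * D ≡ L
  BD≡L = central-certificate n X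
  AD≡R : A * D ≡ R
  AD≡R = begin
    O * genCatalan k′ n * ((2 * k * n) C m) * D   ≡⟨ cong (λ z → O * genCatalan k′ n * (z C m) * D) (*-assoc 2 k n) ⟩
    O * genCatalan k′ n * ((2 * m) C m) * D       ≡⟨ cong (_* D) (*-assoc O _ _) ⟩
    O * (genCatalan k′ n * ((2 * m) C m)) * D     ≡⟨ *-assoc O _ D ⟩
    O * (genCatalan k′ n * ((2 * m) C m) * D)     ≡⟨ cong (O *_) (genCatalan-certificate k′ n′) ⟩
    O * R′                                        ∎
    where open ≡-Reasoning
  ν₂-identity : ν 2 L + s₂ (suc y) ≡ suc (ν 2 R)
  ν₂-identity = trans (ν₂-identity-II y n)
    (cong suc (sym (ν₂-odd-factor O R′ 1≤O (proj₂ (proj₂ (oddPart-spec (k + 1) 1≤k+1))) 1≤R′)))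
  -- At an odd prime p, ν_p((k+1)′) = ν_p(k+1).
  ν-odd≤ : ∀ p → Prime p → p ≢ 2 → ν p L ≤ ν p R
  ν-odd≤ p p-prime p≢2 = begin
    ν p L                          ≤⟨ OddPrime.ν-bound-II p p-prime (odd-prime p-prime p≢2) k′ n ⟩
    ν p (suc k * R′)               ≡⟨ ν-* (suc k) R′ (s≤s z≤n) 1≤R′ ⟩
    ν p (suc k) + ν p R′           ≡⟨ cong (λ z → ν p z + ν p R′) (+-comm 1 k) ⟩
    ν p (k + 1) + ν p R′           ≡⟨ cong (_+ ν p R′) (ν-oddPart p-prime p≢2 (k + 1) 1≤k+1) ⟨
    ν p O + ν p R′                 ≡⟨ ν-* O R′ 1≤O 1≤R′ ⟨
    ν p R                          ∎
    where
    open ≤-Reasoning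
    open PrimeValuation p p-prime using (ν-*)
  ν-L≤R : ∀ p → Prime p → ν p L ≤ ν p R
  ν-L≤R = ν≤-at-all-primes {L} {R} (excess-≤ 0 ν₂-identity (1≤s₂ (suc y) (s≤s z≤n))) ν-odd≤
  quotient-parity : (q : ℕ) → A ≡ q * B → Odd q ⇔ IsPowerOfTwo (y + 1)
  quotient-parity q A≡qB = subst (λ z → Odd q ⇔ IsPowerOfTwo z) (+-comm 1 y)
    (odd⇔power-of-two q (suc y) 1≤q (s≤s z≤n)
      (ν₂-quotient (s₂ (suc y)) 1≤q 1≤L (quotient-by-multiplier q BD≡L AD≡R A≡qB) ν₂-identity))
    where
    1≤q : 1 ≤ q
    1≤q = pos-factorˡ q B (subst (1 ≤_) A≡qB (pos-factorˡ A D (subst (1 ≤_) (sym AD≡R) 1≤R)))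

-- With k = k′+1, h = 2ᵏ − 2 (so 2ᵏ − 1 = h + 1), y = hn, m = n + y and
-- D = n! n! (y+1)! m!:
--   2ᵏ⁻¹ C(2n, n) · D = 2ᵏ⁻¹ (2n)! (y+1)! m!   and   C(2m, m) C_n^(h) · D = n! (2m)!.
-- At 2 the extra factor 2ᵏ⁻¹ is paid for by s₂(y+1) = 1 + s₂((2ᵏ⁻¹ − 1) n) ≥ k.
part-iii : ∀ k′ n′ → let k = suc k′ ; n = suc n′ in
  (2 ^ (k ∸ 1) * ((2 * n) C n)) ∣ (((2 * ((2 ^ k ∸ 1) * n)) C ((2 ^ k ∸ 1) * n)) * genCatalan (2 ^ k ∸ 2) n)
part-iii k′ n′ = subst (λ z → B ∣ ((2 * (z * n)) C (z * n)) * genCatalan h n) (sym 2ᵏ-1≡1+h)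
  (∣-by-multiplier 1≤D BD≡L AD≡R (ν-criterion L R 1≤L 1≤R ν-L≤R))
  where
  k = suc k′
  n = suc n′
  2≤2ᵏ : 2 ≤ 2 ^ k
  2≤2ᵏ = *-monoʳ-≤ 2 (m^n>0 2 k′)
  h = 2 ^ k ∸ 2
  2ᵏ-1≡1+h : 2 ^ k ∸ 1 ≡ suc h
  2ᵏ-1≡1+h = +-∸-assoc 1 {2 ^ k} {2} 2≤2ᵏ
  2+h≡2ᵏ : suc (suc h) ≡ 2 ^ k
  2+h≡2ᵏ = m+[n∸m]≡n 2≤2ᵏ
  y = h * n
  m = n + y
  P = 2 ^ k′
  A = ((2 * m) C m) * genCatalan h n
  B = P * ((2 * n) C n)
  X = suc y ! * m !
  D = (n ! * n !) * X
  L′ = (2 * n) ! * X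
  L = P * L′
  R = n ! * (2 * m) !
  1≤D : 1 ≤ D
  1≤D = *-mono-≤ (1≤!*! n n) (1≤!*! (suc y) m)
  1≤L′ : 1 ≤ L′
  1≤L′ = *-mono-≤ (1≤n! (2 * n)) (1≤!*! (suc y) m)
  1≤L : 1 ≤ L
  1≤L = *-mono-≤ (m^n>0 2 k′) 1≤L′
  1≤R : 1 ≤ R
  1≤R = 1≤!*! n (2 * m)
  BD≡L : B * D ≡ L
  BD≡L = trans (*-assoc P _ D) (cong (P *_) (central-certificate n X))
  AD≡R : A * D ≡ R
  AD≡R = trans (cong (_* D) (*-comm ((2 * m) C m) _)) (genCatalan-certificate h n′)
  -- y + 1 = 2 (2ᵏ⁻¹ − 1) n + 1 has at least k binary digits equal to one.
  k≤s₂ : k ≤ s₂ (suc y)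
  k≤s₂ = begin
    suc k′                                  ≤⟨ s≤s (s₂-multiple-of-ones k′ n (s≤s z≤n)) ⟩
    suc (s₂ ((2 ^ k′ ∸ 1) * n))             ≡⟨ s₂-odd ((2 ^ k′ ∸ 1) * n) ⟨
    s₂ (suc (2 * ((2 ^ k′ ∸ 1) * n)))       ≡⟨ cong (λ z → s₂ (suc z)) y≡ ⟨
    s₂ (suc y)                              ∎
    where
    open ≤-Reasoning
    y≡ : y ≡ 2 * ((2 ^ k′ ∸ 1) * n)
    y≡ = trans (cong (_* n) (sym (*-distribˡ-∸ 2 (2 ^ k′) 1))) (*-assoc 2 (2 ^ k′ ∸ 1) n)
  ν₂-L≤R : ν 2 L ≤ ν 2 R
  ν₂-L≤R = begin
    ν 2 (P * L′)          ≡⟨ ν₂-* P L′ (m^n>0 2 k′) 1≤L′ ⟩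
    ν 2 P + ν 2 L′        ≡⟨ cong (_+ ν 2 L′) (ν₂-2^ k′) ⟩
    k′ + ν 2 L′           ≤⟨ excess-≤ k′ (ν₂-identity-II y n) k≤s₂ ⟩
    ν 2 R                 ∎
    where open ≤-Reasoning
  -- At an odd prime p, neither 2ᵏ⁻¹ nor h + 2 = 2ᵏ contributes.
  ν-odd≤ : ∀ p → Prime p → p ≢ 2 → ν p L ≤ ν p R
  ν-odd≤ p p-prime p≢2 = begin
    ν p (P * L′)                   ≡⟨ ν-* P L′ (m^n>0 2 k′) 1≤L′ ⟩
    ν p P + ν p L′                 ≡⟨ cong (_+ ν p L′) (ν-2^ p-prime p≢2 k′) ⟩
    ν p L′                         ≤⟨ OddPrime.ν-bound-II p p-prime (odd-prime p-prime p≢2) h n ⟩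
    ν p (suc (suc h) * R)          ≡⟨ ν-* (suc (suc h)) R (s≤s z≤n) 1≤R ⟩
    ν p (suc (suc h)) + ν p R      ≡⟨ cong (λ z → ν p z + ν p R) 2+h≡2ᵏ ⟩
    ν p (2 ^ k) + ν p R            ≡⟨ cong (_+ ν p R) (ν-2^ p-prime p≢2 k) ⟩
    ν p R                          ∎
    where
    open ≤-Reasoning
    open PrimeValuation p p-prime using (ν-*)
  ν-L≤R : ∀ p → Prime p → ν p L ≤ ν p R
  ν-L≤R = ν≤-at-all-primes {L} {R} ν₂-L≤R ν-odd≤

theorem1p2 : (k n : ℕ) → 1 ≤ k → 1 ≤ n →
      ((((k * n) C n) ∣ ((2 * k ∸ 1) * catalan n * ((2 * k * n) C (2 * n))))
        × ((q : ℕ) → (2 * k ∸ 1) * catalan n * ((2 * k * n) C (2 * n)) ≡ q * ((k * n) C n)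
            → (Odd q ⇔ IsPowerOfTwo (n + 1))))
      × ((((2 * n) C n) ∣ (oddPart (k + 1) * genCatalan (k ∸ 1) n * ((2 * k * n) C (k * n))))
        × ((q : ℕ) → oddPart (k + 1) * genCatalan (k ∸ 1) n * ((2 * k * n) C (k * n)) ≡ q * ((2 * n) C n)
            → (Odd q ⇔ IsPowerOfTwo ((k ∸ 1) * n + 1))))
      × ((2 ^ (k ∸ 1) * ((2 * n) C n)) ∣ (((2 * ((2 ^ k ∸ 1) * n)) C ((2 ^ k ∸ 1) * n)) * genCatalan (2 ^ k ∸ 2) n))
theorem1p2 (suc k′) (suc n′) _ _ = part-i k′ n′ , part-ii k′ n′ , part-iii k′ n′
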